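{- For every $\pi\in S_n$, $2c_{odd}(\Gamma(\pi))\leq n-1+c_{odd}(\Gamma(\overline{\pi}))$.
   Context: Permutations are composed right to left; $\pi\in S_n$ is written $\langle \pi_1\ \cdots\ \pi_n\rangle$, $\pi_i=\pi(i)$, and identified with the permutation of $\{0,\ldots,n\}$ fixing $0$ when forming $\overline{\pi}=(0,1,2,\ldots,n)\circ(0,\pi_n,\pi_{n-1},\ldots,\pi_1)$, a permutation of $\{0,\ldots,n\}$. For a permutation $\sigma$ of a finite set, $\Gamma(\sigma)$ is its functional digraph and $c_{odd}(\Gamma(\sigma))$ is the number of cycles of $\sigma$ of odd length (number of elements), fixed points included. Here $\Gamma(\pi)$ is the digraph of $\pi$ as a permutation of $\{1,\ldots,n\}$. -}

module Defs where

open import Data.Nat as ℕ using (ℕ; zero; suc; _+_; _<?_)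
open import Data.Nat.DivMod using (_%_)
open import Data.Fin as Fin using (Fin; zero; suc; toℕ; fromℕ; fromℕ<; inject₁)
open import Data.Fin.Properties using (_≟_)
open import Data.Fin.Permutation using (Permutation′; _⟨$⟩ʳ_; _⟨$⟩ˡ_)
open import Data.List using (List; length; filter; allFin; upTo)
open import Data.List.Relation.Unary.All using (All)
open import Data.Product using (_×_)
open import Relation.Nullary using (Dec; yes; no)
open import Relation.Nullary.Decidable using (_×-dec_)
open import Data.List.Relation.Unary.All using (all?)
open import Relation.Binary.PropositionalEquality using (_≡_)

-- Cycles of a permutation given as a function f : Fin m → Fin m
-- (all functions below are only applied to bijections).

iter : ∀ {m} → (Fin m → Fin m) → ℕ → Fin m → Fin m
iter f zero    x = x
iter f (suc k) x = f (iter f k x)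

search : ∀ {m} → (Fin m → Fin m) → Fin m → ℕ → ℕ → ℕ
search f x k zero = k
search f x k (suc fuel) with iter f k x ≟ x
... | yes _ = k
... | no  _ = search f x (suc k) fuel

-- length of the cycle of f containing x: least k ≥ 1 with f^k x = x
-- (for a permutation of an m-element set this is ≤ m, so the search is exact)
cycleLength : ∀ {m} → (Fin m → Fin m) → Fin m → ℕ
cycleLength {m} f x = search f x 1 m

IsCycleRep : ∀ {m} → (Fin m → Fin m) → Fin m → Set
IsCycleRep f x = All (λ j → toℕ x ℕ.≤ toℕ (iter f j x)) (upTo (cycleLength f x))

isCycleRep? : ∀ {m} (f : Fin m → Fin m) (x : Fin m) → Dec (IsCycleRep f x)
isCycleRep? f x = all? (λ j → toℕ x ℕ.≤? toℕ (iter f j x)) (upTo (cycleLength f x))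

-- c_odd(Γ(f)) : number of cycles of f of odd length (fixed points included),
-- counted as the number of cycle representatives whose cycle length is odd
cOdd : ∀ {m} → (Fin m → Fin m) → ℕ
cOdd {m} f = length (filter (λ x → isCycleRep? f x ×-dec (cycleLength f x % 2 ℕ.≟ 1)) (allFin m))

-- π̄ = (0,1,…,n) ∘ (0,π_n,π_{n-1},…,π_1)  on {0,…,n} ≅ Fin (suc n),
-- where the value v ∈ {1..n} is the Fin element suc (v-1), and π
-- (on Fin n, 0-indexed: π_i = value of π at position i-1) fixes 0.

-- the cycle (0, π_n, π_{n-1}, …, π_1) : 0 ↦ π_n, π_i ↦ π_{i-1} (i ≥ 2), π_1 ↦ 0
revCycle : ∀ {n} → Permutation′ n → Fin (suc n) → Fin (suc n)
revCycle {zero}  π zero    = zero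
revCycle {suc m} π zero    = suc (π ⟨$⟩ʳ fromℕ m)
revCycle {suc m} π (suc y) with π ⟨$⟩ˡ y
... | zero  = zero
... | suc j = suc (π ⟨$⟩ʳ inject₁ j)

shiftCycle : ∀ {n} → Fin (suc n) → Fin (suc n)
shiftCycle {n} k with toℕ k <? n
... | yes p = suc (fromℕ< p)
... | no  _ = zero

piBar : ∀ {n} → Permutation′ n → Fin (suc n) → Fin (suc n)
piBar π k = shiftCycle (revCycle π k)

-- Let d(σ) = m − c_odd(σ) for a permutation σ of m points. Composing σ with a transposition
-- either merges two cycles or splits one, so c_odd changes by 0 or ±2; composing with two
-- overlapping transpositions (a 3-cycle) also lowers c_odd by at most 2, because merging two
-- odd cycles produces an even one. Writing τ as a product of one transposition per even cycle
-- and 3-cycles otherwise, with d(τ)/2 factors in all, gives d(στ) ≤ d(σ) + d(τ). The effect of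
-- a transposition on the cycles is proved by induction on m, cutting a point out of its cycle.
-- Finally π̄ = s π̂ s⁻¹ π̂⁻¹, where π̂ is π extended by the fixed point 0 and s = (0 1 … n);
-- conjugation and inversion preserve c_odd and c_odd(π̂) = c_odd(π) + 1, so subadditivity
-- gives 2 (c_odd(π) + 1) ≤ (n + 1) + c_odd(π̄).

module Submission where

open import Defs
open import Data.Nat as ℕ using (ℕ; zero; suc; _+_; _*_; _∸_; _≤_; _<_; z≤n; s≤s; _%_; _≤?_; _<?_)
open import Data.Nat.Properties hiding (_≟_)
open import Data.Fin using (Fin; zero; suc; toℕ; punchIn; punchOut; fromℕ; fromℕ<; inject₁)
open import Data.Fin.Properties as Finₚ
  using (_≟_; any?; pigeonhole; toℕ<n; toℕ-injective; toℕ-fromℕ; toℕ-fromℕ<; toℕ-inject₁;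
         punchInᵢ≢i; punchIn-injective; punchIn-punchOut; punchIn-mono-≤; punchIn-cancel-≤)
open import Data.Fin.Permutation
  using (Permutation′; permutation; _⟨$⟩ʳ_; _⟨$⟩ˡ_; inverseˡ; inverseʳ; _≈_; _∘ₚ_; flip;
         transpose; remove; lift₀; punchIn-permute)
open import Data.List using (length; filter; tabulate)
open import Data.List.Relation.Unary.All.Properties using (applyUpTo⁺₁; applyUpTo⁻)
open import Data.Product using (∃; ∃-syntax; _×_; _,_; proj₁; proj₂)
open import Data.Sum using (_⊎_; inj₁; inj₂)
open import Data.Empty using (⊥-elim)
open import Function using (_∘_; id)
open import Relation.Nullary using (Dec; yes; no; ¬_)
open import Relation.Nullary.Decidable using (_×-dec_; map′; ¬?)
open import Relation.Binary.Definitions using (tri<; tri≈; tri>)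
open import Relation.Binary.PropositionalEquality
open import Algebra.Properties.CommutativeSemigroup +-commutativeSemigroup using (xy∙z≈zy∙x; xy∙z≈xz∙y)
open import Data.Nat.Tactic.RingSolver using (solve-∀)
open import Algebra.Properties.Semiring.Sum +-*-semiring
  using (sum; sum-remove; ∑-distrib-+; ∑-comm; sum-cong-≗; *-distribʳ-sum)

private
  variable
    m : ℕ


𝟙 : {P : Set} → Dec P → ℕ
𝟙 (yes _) = 1
𝟙 (no  _) = 0

module _ {P : Set} where

  𝟙-yes : P → (p : Dec P) → 𝟙 p ≡ 1
  𝟙-yes x (yes _) = refl
  𝟙-yes x (no ¬x) = ⊥-elim (¬x x)

  𝟙-no : ¬ P → (p : Dec P) → 𝟙 p ≡ 0
  𝟙-no ¬x (yes x) = ⊥-elim (¬x x)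
  𝟙-no ¬x (no _)  = refl

module _ {P Q : Set} where

  𝟙-cong : (P → Q) → (Q → P) → (p : Dec P) (q : Dec Q) → 𝟙 p ≡ 𝟙 q
  𝟙-cong to from p (yes y) = 𝟙-yes (from y) p
  𝟙-cong to from p (no ¬y) = 𝟙-no (¬y ∘ to) p

  𝟙-× : (p : Dec P) (q : Dec Q) → 𝟙 (p ×-dec q) ≡ 𝟙 p * 𝟙 q
  𝟙-× (yes x) (yes y) = refl
  𝟙-× (yes x) (no ¬y) = refl
  𝟙-× (no ¬x) q       = refl

𝟙+𝟙¬ : {P : Set} (p : Dec P) → 𝟙 p + 𝟙 (¬? p) ≡ 1
𝟙+𝟙¬ (yes _) = refl
𝟙+𝟙¬ (no  _) = refl

𝟙-mono : ∀ {P Q : Set} → (P → Q) → (p : Dec P) (q : Dec Q) → 𝟙 p ≤ 𝟙 q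
𝟙-mono P⇒Q (yes x) q      = ≤-reflexive (sym (𝟙-yes (P⇒Q x) q))
𝟙-mono P⇒Q (no _)  q      = z≤n

parity : ℕ → ℕ
parity n = 𝟙 (n % 2 ℕ.≟ 1)

parity-suc : ∀ n → parity (suc n) + parity n ≡ 1
parity-suc zero          = refl
parity-suc (suc zero)    = refl
parity-suc (suc (suc n)) = parity-suc n

parity≤1 : ∀ n → parity n ≤ 1
parity≤1 zero          = z≤n
parity≤1 (suc zero)    = ≤-refl
parity≤1 (suc (suc n)) = parity≤1 n

parity≡0⊎1 : ∀ n → parity n ≡ 0 ⊎ parity n ≡ 1
parity≡0⊎1 zero          = inj₁ refl
parity≡0⊎1 (suc zero)    = inj₂ refl
parity≡0⊎1 (suc (suc n)) = parity≡0⊎1 n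

parity-+ : ∀ a b → parity (a + b) + 2 * (parity a * parity b) ≡ parity a + parity b
parity-+ zero          b = +-identityʳ (parity b)
parity-+ (suc zero)    b = lemma (parity-suc b)
  where
  lemma : ∀ {u v} → u + v ≡ 1 → u + 2 * (1 * v) ≡ 1 + v
  lemma {0} {1} refl = refl
  lemma {1} {0} refl = refl
parity-+ (suc (suc a)) b = parity-+ a b

parity-+-∧ : ∀ a b → parity (a + b) + parity a * parity b ≤ 1
parity-+-∧ zero          b = ≤-trans (≤-reflexive (+-identityʳ (parity b))) (parity≤1 b)
parity-+-∧ (suc zero)    b = ≤-reflexive (trans (cong (parity (suc b) +_) (+-identityʳ (parity b))) (parity-suc b))
parity-+-∧ (suc (suc a)) b = parity-+-∧ a b


sum-1 : ∀ m → sum {m} (λ _ → 1) ≡ m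
sum-1 zero    = refl
sum-1 (suc m) = cong suc (sum-1 m)

sum-mono-≤ : ∀ {m} {g h : Fin m → ℕ} → (∀ x → g x ≤ h x) → sum g ≤ sum h
sum-mono-≤ {zero}  g≤h = z≤n
sum-mono-≤ {suc m} g≤h = +-mono-≤ (g≤h zero) (sum-mono-≤ (g≤h ∘ suc))

sum-𝟙-atMostOne : ∀ {m} {P : Fin m → Set} (P? : ∀ x → Dec (P x)) → (∀ {x y} → P x → P y → x ≡ y) →
                  (∃P? : Dec (∃ P)) → sum (λ x → 𝟙 (P? x)) ≡ 𝟙 ∃P?
sum-𝟙-atMostOne {zero}  P? uniq ∃P? = sym (𝟙-no (λ { (() , _) }) ∃P?)
sum-𝟙-atMostOne {suc m} P? uniq ∃P?
  with P? zero | sum-𝟙-atMostOne (P? ∘ suc) (λ {x} {y} p q → Finₚ.suc-injective (uniq {suc x} {suc y} p q))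
                                  (any? (P? ∘ suc))
... | yes p₀ | rest≡ =
  trans (cong suc (trans rest≡ (𝟙-no (λ (y , py) → Finₚ.0≢1+n (uniq p₀ py)) (any? (P? ∘ suc)))))
        (sym (𝟙-yes (zero , p₀) ∃P?))
... | no ¬p₀ | rest≡ = trans rest≡ (𝟙-cong (λ (y , py) → suc y , py)
                                           (λ { (zero , p₀) → ⊥-elim (¬p₀ p₀) ; (suc y , py) → y , py })
                                           (any? (P? ∘ suc)) ∃P?)

sum-𝟙-unique : ∀ {m} {P : Fin m → Set} (P? : ∀ x → Dec (P x)) {y} → P y →
               (∀ {x z} → P x → P z → x ≡ z) → sum (λ x → 𝟙 (P? x)) ≡ 1
sum-𝟙-unique P? {y} py uniq = trans (sum-𝟙-atMostOne P? uniq (any? P?)) (𝟙-yes (y , py) (any? P?))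

length-filter-tabulate : ∀ {A : Set} {P : A → Set} (P? : ∀ a → Dec (P a)) {m} (h : Fin m → A) →
                         length (filter P? (tabulate h)) ≡ sum (λ i → 𝟙 (P? (h i)))
length-filter-tabulate P? {zero}  h = refl
length-filter-tabulate P? {suc m} h with P? (h zero)
... | yes _ = cong suc (length-filter-tabulate P? (h ∘ suc))
... | no  _ = length-filter-tabulate P? (h ∘ suc)

least : ∀ {m} {P : Fin m → Set} (P? : ∀ x → Dec (P x)) {x₀} → P x₀ →
        ∃[ y ] P y × (∀ {z} → P z → toℕ y ≤ toℕ z)
least {suc m} P? {zero}   p₀ = zero , p₀ , λ _ → z≤n
least {suc m} P? {suc x₀} px₀ with P? zero
... | yes p₀ = zero , p₀ , λ _ → z≤n
... | no ¬p₀ with least (P? ∘ suc) px₀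
...   | y , py , minimal = suc y , py , λ { {zero} p₀ → ⊥-elim (¬p₀ p₀) ; {suc z} pz → s≤s (minimal pz) }


module _ {m} (f : Fin m → Fin m) where

  iter-sucʳ : ∀ k x → iter f (suc k) x ≡ iter f k (f x)
  iter-sucʳ zero    x = refl
  iter-sucʳ (suc k) x = cong f (iter-sucʳ k x)

  iter-+ : ∀ a b x → iter f (a + b) x ≡ iter f a (iter f b x)
  iter-+ zero    b x = refl
  iter-+ (suc a) b x = cong f (iter-+ a b x)

  iter-fixed : ∀ {x} → f x ≡ x → ∀ k → iter f k x ≡ x
  iter-fixed fx zero    = refl
  iter-fixed fx (suc k) = trans (cong f (iter-fixed fx k)) fx

  module _ (x : Fin m) where

    search-≥ : ∀ k fuel → k ≤ search f x k fuel
    search-≥ k zero = ≤-refl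
    search-≥ k (suc fuel) with iter f k x ≟ x
    ... | yes _ = ≤-refl
    ... | no  _ = ≤-trans (n≤1+n k) (search-≥ (suc k) fuel)

    search-minimal : ∀ k fuel {i} → k ≤ i → i < search f x k fuel → iter f i x ≢ x
    search-minimal k zero       k≤i i<s = ⊥-elim (<-irrefl refl (≤-trans i<s k≤i))
    search-minimal k (suc fuel) k≤i i<s with iter f k x ≟ x
    ... | yes _ = ⊥-elim (<-irrefl refl (≤-trans i<s k≤i))
    ... | no fᵏx≢x with m≤n⇒m<n∨m≡n k≤i
    ...   | inj₁ k<i  = search-minimal (suc k) fuel k<i i<s
    ...   | inj₂ refl = fᵏx≢x

    search-found : ∀ k fuel → search f x k fuel < k + fuel → iter f (search f x k fuel) x ≡ x
    search-found k zero       s<k = ⊥-elim (<-irrefl (sym (+-identityʳ k)) s<k)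
    search-found k (suc fuel) s<k with iter f k x ≟ x
    ... | yes fᵏx≡x = fᵏx≡x
    ... | no  _     = search-found (suc k) fuel (≤-trans s<k (≤-reflexive (+-suc k fuel)))

module _ {m} {f g : Fin m → Fin m} (f≗g : ∀ x → f x ≡ g x) where

  iter-cong : ∀ k x → iter f k x ≡ iter g k x
  iter-cong zero    x = refl
  iter-cong (suc k) x = trans (f≗g _) (cong g (iter-cong k x))

  search-cong : ∀ x k fuel → search f x k fuel ≡ search g x k fuel
  search-cong x k zero = refl
  search-cong x k (suc fuel) with iter f k x ≟ x | iter g k x ≟ x
  ... | yes _ | yes _ = refl
  ... | yes p | no ¬q = ⊥-elim (¬q (trans (sym (iter-cong k x)) p))
  ... | no ¬p | yes q = ⊥-elim (¬p (trans (iter-cong k x) q))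
  ... | no  _ | no  _ = search-cong x (suc k) fuel

  cycleLength-cong : ∀ x → cycleLength f x ≡ cycleLength g x
  cycleLength-cong x = search-cong x 1 m

  IsCycleRep-cong : ∀ {x} → IsCycleRep f x → IsCycleRep g x
  IsCycleRep-cong {x} rep = applyUpTo⁺₁ id (cycleLength g x) λ {j} j<ℓ →
    subst (λ y → toℕ x ≤ toℕ y) (iter-cong j x)
          (applyUpTo⁻ id (cycleLength f x) rep (subst (j <_) (sym (cycleLength-cong x)) j<ℓ))

cOdd-sum : ∀ {m} (f : Fin m → Fin m) →
           cOdd f ≡ sum (λ x → 𝟙 (isCycleRep? f x) * parity (cycleLength f x))
cOdd-sum f = trans (length-filter-tabulate (λ x → isCycleRep? f x ×-dec (cycleLength f x % 2 ℕ.≟ 1)) id)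
                   (sum-cong-≗ λ x → 𝟙-× (isCycleRep? f x) _)

cOdd-cong : ∀ {m} {f g : Fin m → Fin m} → (∀ x → f x ≡ g x) → cOdd f ≡ cOdd g
cOdd-cong {f = f} {g} f≗g = begin
  cOdd f                                                      ≡⟨ cOdd-sum f ⟩
  sum (λ x → 𝟙 (isCycleRep? f x) * parity (cycleLength f x))  ≡⟨ sum-cong-≗ (λ x → cong₂ _*_
      (𝟙-cong (IsCycleRep-cong f≗g) (IsCycleRep-cong (sym ∘ f≗g)) (isCycleRep? f x) (isCycleRep? g x))
      (cong parity (cycleLength-cong f≗g x))) ⟩
  sum (λ x → 𝟙 (isCycleRep? g x) * parity (cycleLength g x))  ≡⟨ cOdd-sum g ⟨
  cOdd g                                                      ∎
  where open ≡-Reasoning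


oddCycles : Permutation′ m → ℕ
oddCycles σ = cOdd (σ ⟨$⟩ʳ_)

⟨$⟩ʳ-injective : ∀ (σ : Permutation′ m) {x y} → σ ⟨$⟩ʳ x ≡ σ ⟨$⟩ʳ y → x ≡ y
⟨$⟩ʳ-injective σ {x} {y} e = trans (sym (inverseˡ σ)) (trans (cong (σ ⟨$⟩ˡ_) e) (inverseˡ σ))

module Cycles {m} (σ : Permutation′ m) where

  ℓ : Fin m → ℕ
  ℓ = cycleLength (σ ⟨$⟩ʳ_)

  iter-injective : ∀ k {x y} → iter (σ ⟨$⟩ʳ_) k x ≡ iter (σ ⟨$⟩ʳ_) k y → x ≡ y
  iter-injective zero    e = e
  iter-injective (suc k) e = iter-injective k (⟨$⟩ʳ-injective σ e)

  iter-∸ : ∀ {i j} x → i ≤ j → iter (σ ⟨$⟩ʳ_) i x ≡ iter (σ ⟨$⟩ʳ_) j x →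
           iter (σ ⟨$⟩ʳ_) (j ∸ i) x ≡ x
  iter-∸ {i} {j} x i≤j e = iter-injective i (begin
    iter (σ ⟨$⟩ʳ_) i (iter (σ ⟨$⟩ʳ_) (j ∸ i) x)  ≡⟨ iter-+ (σ ⟨$⟩ʳ_) i (j ∸ i) x ⟨
    iter (σ ⟨$⟩ʳ_) (i + (j ∸ i)) x              ≡⟨ cong (λ k → iter (σ ⟨$⟩ʳ_) k x) (m+[n∸m]≡n i≤j) ⟩
    iter (σ ⟨$⟩ʳ_) j x                          ≡⟨ e ⟨
    iter (σ ⟨$⟩ʳ_) i x                          ∎)
    where open ≡-Reasoning

  period : ∀ x → ∃[ p ] 1 ≤ p × p ≤ m × iter (σ ⟨$⟩ʳ_) p x ≡ x
  period x with pigeonhole (n<1+n m) (λ (i : Fin (suc m)) → iter (σ ⟨$⟩ʳ_) (toℕ i) x)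
  ... | i , j , i<j , e = toℕ j ∸ toℕ i , m<n⇒0<n∸m i<j ,
                          ≤-trans (m∸n≤m (toℕ j) (toℕ i)) (≤-pred (toℕ<n j)) , iter-∸ x (<⇒≤ i<j) e

  ℓ-positive : ∀ x → 1 ≤ ℓ x
  ℓ-positive x = search-≥ (σ ⟨$⟩ʳ_) x 1 m

  ℓ-minimal : ∀ x {i} → 1 ≤ i → i < ℓ x → iter (σ ⟨$⟩ʳ_) i x ≢ x
  ℓ-minimal x = search-minimal (σ ⟨$⟩ʳ_) x 1 m

  ℓ≤period : ∀ x {p} → 1 ≤ p → iter (σ ⟨$⟩ʳ_) p x ≡ x → ℓ x ≤ p
  ℓ≤period x {p} 1≤p σᵖx≡x with ℓ x ≤? p
  ... | yes ℓ≤p = ℓ≤p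
  ... | no  ℓ≰p = ⊥-elim (ℓ-minimal x 1≤p (≰⇒> ℓ≰p) σᵖx≡x)

  iter-ℓ : ∀ x → iter (σ ⟨$⟩ʳ_) (ℓ x) x ≡ x
  iter-ℓ x with period x
  ... | p , 1≤p , p≤m , σᵖx≡x =
    search-found (σ ⟨$⟩ʳ_) x 1 m (s≤s (≤-trans (ℓ≤period x 1≤p σᵖx≡x) p≤m))

  ℓ-unique : ∀ x {p} → 1 ≤ p → iter (σ ⟨$⟩ʳ_) p x ≡ x →
             (∀ {i} → 1 ≤ i → i < p → iter (σ ⟨$⟩ʳ_) i x ≢ x) → ℓ x ≡ p
  ℓ-unique x 1≤p σᵖx≡x minimal with m≤n⇒m<n∨m≡n (ℓ≤period x 1≤p σᵖx≡x)
  ... | inj₁ ℓ<p = ⊥-elim (minimal (ℓ-positive x) ℓ<p (iter-ℓ x))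
  ... | inj₂ ℓ≡p = ℓ≡p

  ℓ-fixed : ∀ {x} → σ ⟨$⟩ʳ x ≡ x → ℓ x ≡ 1
  ℓ-fixed σx≡x = ℓ-unique _ ≤-refl σx≡x λ 1≤i i<1 → ⊥-elim (<-irrefl refl (≤-trans i<1 1≤i))

  iter-mod-ℓ : ∀ x k → ∃[ j ] j < ℓ x × iter (σ ⟨$⟩ʳ_) k x ≡ iter (σ ⟨$⟩ʳ_) j x
  iter-mod-ℓ x zero = 0 , ℓ-positive x , refl
  iter-mod-ℓ x (suc k) with iter-mod-ℓ x k
  ... | j , j<ℓ , e with m≤n⇒m<n∨m≡n j<ℓ
  ...   | inj₁ 1+j<ℓ = suc j , 1+j<ℓ , cong (σ ⟨$⟩ʳ_) e
  ...   | inj₂ 1+j≡ℓ = 0 , ℓ-positive x ,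
                       trans (cong (σ ⟨$⟩ʳ_) e) (trans (cong (λ i → iter (σ ⟨$⟩ʳ_) i x) 1+j≡ℓ) (iter-ℓ x))

  iter-injective-<ℓ : ∀ x {i j} → i < ℓ x → j < ℓ x → iter (σ ⟨$⟩ʳ_) i x ≡ iter (σ ⟨$⟩ʳ_) j x → i ≡ j
  iter-injective-<ℓ x {i} {j} i<ℓ j<ℓ e with <-cmp i j
  ... | tri< i<j _ _ = ⊥-elim (ℓ-minimal x (m<n⇒0<n∸m i<j) (≤-<-trans (m∸n≤m j i) j<ℓ)
                                         (iter-∸ x (<⇒≤ i<j) e))
  ... | tri≈ _ i≡j _ = i≡j
  ... | tri> _ _ j<i = ⊥-elim (ℓ-minimal x (m<n⇒0<n∸m j<i) (≤-<-trans (m∸n≤m i j) i<ℓ)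
                                         (iter-∸ x (<⇒≤ j<i) (sym e)))

  infix 4 _~_
  _~_ : Fin m → Fin m → Set
  x ~ y = ∃[ k ] iter (σ ⟨$⟩ʳ_) k x ≡ y

  ~-refl : ∀ {x} → x ~ x
  ~-refl = 0 , refl

  ~-trans : ∀ {x y z} → x ~ y → y ~ z → x ~ z
  ~-trans {x} (a , refl) (b , refl) = b + a , iter-+ (σ ⟨$⟩ʳ_) b a x

  ~-bounded : ∀ {x y} → x ~ y → ∃[ k ] k < ℓ x × iter (σ ⟨$⟩ʳ_) k x ≡ y
  ~-bounded {x} (k , σᵏx≡y) with iter-mod-ℓ x k
  ... | j , j<ℓ , σᵏx≡σʲx = j , j<ℓ , trans (sym σᵏx≡σʲx) σᵏx≡y

  ~-sym : ∀ {x y} → x ~ y → y ~ x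
  ~-sym {x} x~y with ~-bounded x~y
  ... | k , k<ℓ , refl = ℓ x ∸ k , (begin
    iter (σ ⟨$⟩ʳ_) (ℓ x ∸ k) (iter (σ ⟨$⟩ʳ_) k x)  ≡⟨ iter-+ (σ ⟨$⟩ʳ_) (ℓ x ∸ k) k x ⟨
    iter (σ ⟨$⟩ʳ_) (ℓ x ∸ k + k) x                ≡⟨ cong (λ i → iter (σ ⟨$⟩ʳ_) i x) (m∸n+n≡m (<⇒≤ k<ℓ)) ⟩
    iter (σ ⟨$⟩ʳ_) (ℓ x) x                        ≡⟨ iter-ℓ x ⟩
    x                                             ∎)
    where open ≡-Reasoning

  ~⇒∃Fin : ∀ {x y} → x ~ y → ∃ λ (k : Fin (ℓ x)) → iter (σ ⟨$⟩ʳ_) (toℕ k) x ≡ y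
  ~⇒∃Fin x~y with ~-bounded x~y
  ... | k , k<ℓ , σᵏx≡y = fromℕ< k<ℓ , trans (cong (λ i → iter (σ ⟨$⟩ʳ_) i _) (toℕ-fromℕ< k<ℓ)) σᵏx≡y

  ∃Fin⇒~ : ∀ {x y} → (∃ λ (k : Fin (ℓ x)) → iter (σ ⟨$⟩ʳ_) (toℕ k) x ≡ y) → x ~ y
  ∃Fin⇒~ (k , e) = toℕ k , e

  infix 4 _~?_
  _~?_ : ∀ x y → Dec (x ~ y)
  x ~? y = map′ ∃Fin⇒~ ~⇒∃Fin (any? λ k → iter (σ ⟨$⟩ʳ_) (toℕ k) x ≟ y)

  ℓ-step : ∀ x → ℓ (σ ⟨$⟩ʳ x) ≡ ℓ x
  ℓ-step x = ℓ-unique (σ ⟨$⟩ʳ x) (ℓ-positive x)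
    (trans (sym (iter-sucʳ (σ ⟨$⟩ʳ_) (ℓ x) x)) (cong (σ ⟨$⟩ʳ_) (iter-ℓ x)))
    (λ {i} 1≤i i<ℓ e → ℓ-minimal x 1≤i i<ℓ (iter-injective 1 (trans (iter-sucʳ (σ ⟨$⟩ʳ_) i x) e)))

  ℓ-cong : ∀ {x y} → x ~ y → ℓ x ≡ ℓ y
  ℓ-cong {x} (zero  , refl) = refl
  ℓ-cong {x} (suc k , refl) = trans (ℓ-cong (k , refl)) (sym (ℓ-step _))

  orbit-size : ∀ x → sum (λ y → 𝟙 (x ~? y)) ≡ ℓ x
  orbit-size x = begin
    sum (λ y → 𝟙 (x ~? y))                                          ≡⟨ sum-cong-≗ hits ⟨
    sum (λ y → sum (λ (k : Fin (ℓ x)) → 𝟙 (iter (σ ⟨$⟩ʳ_) (toℕ k) x ≟ y)))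
      ≡⟨ ∑-comm (λ y (k : Fin (ℓ x)) → 𝟙 (iter (σ ⟨$⟩ʳ_) (toℕ k) x ≟ y)) ⟩
    sum (λ (k : Fin (ℓ x)) → sum (λ y → 𝟙 (iter (σ ⟨$⟩ʳ_) (toℕ k) x ≟ y)))
      ≡⟨ sum-cong-≗ hitsOnce ⟩
    sum (λ (k : Fin (ℓ x)) → 1)                                     ≡⟨ sum-1 (ℓ x) ⟩
    ℓ x                                                             ∎
    where
    open ≡-Reasoning
    hits : ∀ y → sum (λ (k : Fin (ℓ x)) → 𝟙 (iter (σ ⟨$⟩ʳ_) (toℕ k) x ≟ y)) ≡ 𝟙 (x ~? y)
    hits y = trans (sum-𝟙-atMostOne hit? (λ e e′ → toℕ-injective
                      (iter-injective-<ℓ x (toℕ<n _) (toℕ<n _) (trans e (sym e′)))) (any? hit?))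
                   (𝟙-cong ∃Fin⇒~ ~⇒∃Fin (any? hit?) (x ~? y))
      where
      hit? = λ (k : Fin (ℓ x)) → iter (σ ⟨$⟩ʳ_) (toℕ k) x ≟ y
    hitsOnce : ∀ (k : Fin (ℓ x)) → sum (λ y → 𝟙 (iter (σ ⟨$⟩ʳ_) (toℕ k) x ≟ y)) ≡ 1
    hitsOnce k = sum-𝟙-unique (iter (σ ⟨$⟩ʳ_) (toℕ k) x ≟_) refl (λ e e′ → trans (sym e) e′)

  IsCycleRep⇒minimal : ∀ {x y} → IsCycleRep (σ ⟨$⟩ʳ_) x → x ~ y → toℕ x ≤ toℕ y
  IsCycleRep⇒minimal {x} rep x~y with ~-bounded x~y
  ... | k , k<ℓ , refl = applyUpTo⁻ id (ℓ x) rep k<ℓ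

  minimal⇒IsCycleRep : ∀ {x} → (∀ {y} → x ~ y → toℕ x ≤ toℕ y) → IsCycleRep (σ ⟨$⟩ʳ_) x
  minimal⇒IsCycleRep {x} minimal = applyUpTo⁺₁ id (ℓ x) λ {k} _ → minimal (k , refl)

  isRep : Fin m → ℕ
  isRep x = 𝟙 (isCycleRep? (σ ⟨$⟩ʳ_) x)

  oddRep : Fin m → ℕ
  oddRep x = isRep x * parity (ℓ x)

  oddCycles-sum : oddCycles σ ≡ sum oddRep
  oddCycles-sum = cOdd-sum (σ ⟨$⟩ʳ_)

  uniqueRep : ∀ x → sum (λ y → 𝟙 (x ~? y) * isRep y) ≡ 1
  uniqueRep x with least (x ~?_) (~-refl {x})
  ... | y , x~y , minimal = trans (sum-cong-≗ λ z → sym (𝟙-× (x ~? z) (isCycleRep? _ z)))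
    (sum-𝟙-unique (λ z → x ~? z ×-dec isCycleRep? _ z)
                  (x~y , minimal⇒IsCycleRep (minimal ∘ ~-trans x~y))
                  λ (x~z , rep) (x~z′ , rep′) → toℕ-injective (≤-antisym
                    (IsCycleRep⇒minimal rep (~-trans (~-sym x~z) x~z′))
                    (IsCycleRep⇒minimal rep′ (~-trans (~-sym x~z′) x~z))))

  oddCyclesAvoiding : Fin m → ℕ
  oddCyclesAvoiding x = sum (λ y → 𝟙 (¬? (x ~? y)) * oddRep y)

  oddCycles-split : ∀ x → oddCycles σ ≡ parity (ℓ x) + oddCyclesAvoiding x
  oddCycles-split x = begin
    oddCycles σ                                                     ≡⟨ oddCycles-sum ⟩
    sum oddRep                                                      ≡⟨ sum-cong-≗ split ⟩
    sum (λ y → 𝟙 (x ~? y) * oddRep y + 𝟙 (¬? (x ~? y)) * oddRep y)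
      ≡⟨ ∑-distrib-+ (λ y → 𝟙 (x ~? y) * oddRep y) (λ y → 𝟙 (¬? (x ~? y)) * oddRep y) ⟩
    sum (λ y → 𝟙 (x ~? y) * oddRep y) + A                           ≡⟨ cong (_+ A) (sum-cong-≗ onOrbit) ⟩
    sum (λ y → 𝟙 (x ~? y) * isRep y * parity (ℓ x)) + A
      ≡⟨ cong (_+ A) (*-distribʳ-sum (parity (ℓ x)) (λ y → 𝟙 (x ~? y) * isRep y)) ⟨
    sum (λ y → 𝟙 (x ~? y) * isRep y) * parity (ℓ x) + A             ≡⟨ cong (λ n → n * parity (ℓ x) + A) (uniqueRep x) ⟩
    1 * parity (ℓ x) + A                                            ≡⟨ cong (_+ A) (*-identityˡ _) ⟩
    parity (ℓ x) + A                                                ∎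
    where
    open ≡-Reasoning
    A = oddCyclesAvoiding x
    split : ∀ y → oddRep y ≡ 𝟙 (x ~? y) * oddRep y + 𝟙 (¬? (x ~? y)) * oddRep y
    split y = trans (sym (*-identityˡ (oddRep y))) (trans (cong (_* oddRep y) (sym (𝟙+𝟙¬ (x ~? y))))
                                                          (*-distribʳ-+ (oddRep y) (𝟙 (x ~? y)) (𝟙 (¬? (x ~? y)))))
    onOrbit : ∀ y → 𝟙 (x ~? y) * oddRep y ≡ 𝟙 (x ~? y) * isRep y * parity (ℓ x)
    onOrbit y with x ~? y
    ... | yes x~y = trans (sym (*-assoc 1 (isRep y) _)) (cong (λ n → 1 * isRep y * parity n) (sym (ℓ-cong x~y)))
    ... | no  _   = refl

infix 4 _~[_]_
_~[_]_ : Fin m → Permutation′ m → Fin m → Set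
x ~[ σ ] y = Cycles._~_ σ x y

module _ {m} {σ ρ : Permutation′ m} (σ≈ρ : σ ≈ ρ) where

  ~-resp-≈ : ∀ {x y} → x ~[ σ ] y → x ~[ ρ ] y
  ~-resp-≈ {x} (k , e) = k , trans (sym (iter-cong σ≈ρ k x)) e

  ℓ-resp-≈ : ∀ x → Cycles.ℓ σ x ≡ Cycles.ℓ ρ x
  ℓ-resp-≈ = cycleLength-cong σ≈ρ


data TransposeView {m} (i j k : Fin m) : Fin m → Set where
  at-i  : k ≡ i → TransposeView i j k j
  at-j  : k ≢ i → k ≡ j → TransposeView i j k i
  other : k ≢ i → k ≢ j → TransposeView i j k k

transpose-view : ∀ (i j k : Fin m) → TransposeView i j k (transpose i j ⟨$⟩ʳ k)
transpose-view i j k with k ≟ i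
... | yes k≡i = at-i k≡i
... | no  k≢i with k ≟ j
...   | yes k≡j = at-j k≢i k≡j
...   | no  k≢j = other k≢i k≢j

transpose-i : ∀ (i j : Fin m) → transpose i j ⟨$⟩ʳ i ≡ j
transpose-i i j with transpose i j ⟨$⟩ʳ i | transpose-view i j i
... | _ | at-i _       = refl
... | _ | at-j i≢i _  = ⊥-elim (i≢i refl)
... | _ | other i≢i _ = ⊥-elim (i≢i refl)

transpose-j : ∀ (i j : Fin m) → transpose i j ⟨$⟩ʳ j ≡ i
transpose-j i j with transpose i j ⟨$⟩ʳ j | transpose-view i j j
... | _ | at-i j≡i    = j≡i
... | _ | at-j _ _    = refl
... | _ | other _ j≢j = ⊥-elim (j≢j refl)

transpose-other : ∀ {i j k : Fin m} → k ≢ i → k ≢ j → transpose i j ⟨$⟩ʳ k ≡ k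
transpose-other {i = i} {j} {k} k≢i k≢j with transpose i j ⟨$⟩ʳ k | transpose-view i j k
... | _ | at-i k≡i    = ⊥-elim (k≢i k≡i)
... | _ | at-j _ k≡j  = ⊥-elim (k≢j k≡j)
... | _ | other _ _   = refl

transpose-involutive : ∀ (i j k : Fin m) → transpose i j ⟨$⟩ʳ (transpose i j ⟨$⟩ʳ k) ≡ k
transpose-involutive i j k with transpose i j ⟨$⟩ʳ k | transpose-view i j k
... | _ | at-i refl       = transpose-j k j
... | _ | at-j _ refl     = transpose-i i k
... | _ | other k≢i k≢j   = transpose-other k≢i k≢j

transpose-comm : ∀ (i j k : Fin m) → transpose i j ⟨$⟩ʳ k ≡ transpose j i ⟨$⟩ʳ k
transpose-comm i j k with transpose i j ⟨$⟩ʳ k | transpose-view i j k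
... | _ | at-i refl       = sym (transpose-j j k)
... | _ | at-j _ refl     = sym (transpose-i k i)
... | _ | other k≢i k≢j   = sym (transpose-other k≢j k≢i)

punchIn-transpose : ∀ (r : Fin (suc m)) i j k →
  punchIn r (transpose i j ⟨$⟩ʳ k) ≡ transpose (punchIn r i) (punchIn r j) ⟨$⟩ʳ punchIn r k
punchIn-transpose r i j k with transpose i j ⟨$⟩ʳ k | transpose-view i j k
... | _ | at-i refl       = sym (transpose-i (punchIn r k) (punchIn r j))
... | _ | at-j _ refl     = sym (transpose-j (punchIn r i) (punchIn r k))
... | _ | other k≢i k≢j   =
  sym (transpose-other (k≢i ∘ punchIn-injective r _ _) (k≢j ∘ punchIn-injective r _ _))


-- Deleting a point from its cycle

punchIn-onto : ∀ {r y : Fin (suc m)} → y ≢ r → ∃[ j ] punchIn r j ≡ y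
punchIn-onto y≢r = punchOut (y≢r ∘ sym) , punchIn-punchOut (y≢r ∘ sym)

-- σ with r cut out of its cycle (σ⁻¹ r ↦ σ r): composing with the transposition (r, σ r)
-- makes r a fixed point, which is then removed.
_∖_ : Permutation′ (suc m) → Fin (suc m) → Permutation′ m
σ ∖ r = remove r (σ ∘ₚ transpose r (σ ⟨$⟩ʳ r))

data ∖-View (σ : Permutation′ (suc m)) (r : Fin (suc m)) (i : Fin m) : Set where
  hits-r   : σ ⟨$⟩ʳ punchIn r i ≡ r → punchIn r ((σ ∖ r) ⟨$⟩ʳ i) ≡ σ ⟨$⟩ʳ r → ∖-View σ r i
  misses-r : σ ⟨$⟩ʳ punchIn r i ≢ r → punchIn r ((σ ∖ r) ⟨$⟩ʳ i) ≡ σ ⟨$⟩ʳ punchIn r i → ∖-View σ r i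

∖-view : ∀ (σ : Permutation′ (suc m)) r i → ∖-View σ r i
∖-view σ r i = cases (transpose-view r (σ ⟨$⟩ʳ r) (σ ⟨$⟩ʳ punchIn r i)) punchIn-∖
  where
  punchIn-∖ : punchIn r ((σ ∖ r) ⟨$⟩ʳ i) ≡ transpose r (σ ⟨$⟩ʳ r) ⟨$⟩ʳ (σ ⟨$⟩ʳ punchIn r i)
  punchIn-∖ = sym (trans (punchIn-permute (σ ∘ₚ transpose r (σ ⟨$⟩ʳ r)) r i)
                         (cong (λ z → punchIn z ((σ ∖ r) ⟨$⟩ʳ i)) (transpose-j r (σ ⟨$⟩ʳ r))))

  cases : ∀ {t} → TransposeView r (σ ⟨$⟩ʳ r) (σ ⟨$⟩ʳ punchIn r i) t →
          punchIn r ((σ ∖ r) ⟨$⟩ʳ i) ≡ t → ∖-View σ r i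
  cases (at-i σLi≡r)    p = hits-r σLi≡r p
  cases (at-j _ σLi≡σr) p = ⊥-elim (punchInᵢ≢i r i (⟨$⟩ʳ-injective σ σLi≡σr))
  cases (other σLi≢r _) p = misses-r σLi≢r p

module Deletion {m} (σ : Permutation′ (suc m)) (r : Fin (suc m)) where

  open Cycles σ
  module D = Cycles (σ ∖ r)

  ∖-iter⇒iter : ∀ k i → ∃[ k′ ] punchIn r (iter ((σ ∖ r) ⟨$⟩ʳ_) k i) ≡ iter (σ ⟨$⟩ʳ_) k′ (punchIn r i)
  ∖-iter⇒iter zero    i = 0 , refl
  ∖-iter⇒iter (suc k) i with ∖-iter⇒iter k i | ∖-view σ r (iter ((σ ∖ r) ⟨$⟩ʳ_) k i)
  ... | k′ , e | hits-r σy≡r step =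
    suc (suc k′) , trans step (trans (cong (σ ⟨$⟩ʳ_) (sym σy≡r)) (cong (λ y → σ ⟨$⟩ʳ (σ ⟨$⟩ʳ y)) e))
  ... | k′ , e | misses-r _ step = suc k′ , trans step (cong (σ ⟨$⟩ʳ_) e)

  -- The second component covers the step past r, which σ ∖ r skips.
  iter⇒∖-iter : ∀ i k →
    (iter (σ ⟨$⟩ʳ_) k (punchIn r i) ≢ r →
       ∃[ k′ ] punchIn r (iter ((σ ∖ r) ⟨$⟩ʳ_) k′ i) ≡ iter (σ ⟨$⟩ʳ_) k (punchIn r i)) ×
    (iter (σ ⟨$⟩ʳ_) k (punchIn r i) ≡ r →
       ∃[ k′ ] punchIn r (iter ((σ ∖ r) ⟨$⟩ʳ_) k′ i) ≡ iter (σ ⟨$⟩ʳ_) (suc k) (punchIn r i))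
  iter⇒∖-iter i zero = (λ _ → 0 , refl) , (λ Li≡r → ⊥-elim (punchInᵢ≢i r i Li≡r))
  iter⇒∖-iter i (suc k) with iter (σ ⟨$⟩ʳ_) k (punchIn r i) ≟ r
  ... | yes σᵏLi≡r = (λ _ → proj₂ (iter⇒∖-iter i k) σᵏLi≡r) , λ σᵏ⁺¹Li≡r →
    let σr≡r = trans (cong (σ ⟨$⟩ʳ_) (sym σᵏLi≡r)) σᵏ⁺¹Li≡r
    in  ⊥-elim (punchInᵢ≢i r i (iter-injective k (trans σᵏLi≡r (sym (iter-fixed (σ ⟨$⟩ʳ_) σr≡r k)))))
  ... | no  σᵏLi≢r with proj₁ (iter⇒∖-iter i k) σᵏLi≢r
  ...   | k′ , e with ∖-view σ r (iter ((σ ∖ r) ⟨$⟩ʳ_) k′ i)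
  ...     | hits-r σy≡r step = (λ σᵏ⁺¹Li≢r → ⊥-elim (σᵏ⁺¹Li≢r (trans (cong (σ ⟨$⟩ʳ_) (sym e)) σy≡r))) ,
                                 (λ σᵏ⁺¹Li≡r → suc k′ , trans step (cong (σ ⟨$⟩ʳ_) (sym σᵏ⁺¹Li≡r)))
  ...     | misses-r σy≢r step = (λ _ → suc k′ , trans step (cong (σ ⟨$⟩ʳ_) e)) ,
                                 (λ σᵏ⁺¹Li≡r → ⊥-elim (σy≢r (trans (cong (σ ⟨$⟩ʳ_) e) σᵏ⁺¹Li≡r)))

  ~∖⇒~ : ∀ {i j} → i D.~ j → punchIn r i ~ punchIn r j
  ~∖⇒~ {i} (k , refl) with ∖-iter⇒iter k i
  ... | k′ , e = k′ , sym e

  ~⇒~∖ : ∀ {i j} → punchIn r i ~ punchIn r j → i D.~ j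
  ~⇒~∖ {i} {j} (k , e) with proj₁ (iter⇒∖-iter i k) (λ σᵏLi≡r → punchInᵢ≢i r j (trans (sym e) σᵏLi≡r))
  ... | k′ , e′ = k′ , punchIn-injective r _ _ (trans e′ e)

  ℓ-∖ : ∀ i → D.ℓ i + 𝟙 (punchIn r i ~? r) ≡ ℓ (punchIn r i)
  ℓ-∖ i = begin
    D.ℓ i + 𝟙 (punchIn r i ~? r)                              ≡⟨ +-comm (D.ℓ i) _ ⟩
    𝟙 (punchIn r i ~? r) + D.ℓ i                              ≡⟨ cong (𝟙 (punchIn r i ~? r) +_) (D.orbit-size i) ⟨
    𝟙 (punchIn r i ~? r) + sum (λ j → 𝟙 (i D.~? j))
      ≡⟨ cong (𝟙 (punchIn r i ~? r) +_) (sum-cong-≗ λ j → 𝟙-cong ~∖⇒~ ~⇒~∖ (i D.~? j) _) ⟩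
    𝟙 (punchIn r i ~? r) + sum (λ j → 𝟙 (punchIn r i ~? punchIn r j))
      ≡⟨ sum-remove (λ y → 𝟙 (punchIn r i ~? y)) ⟨
    sum (λ y → 𝟙 (punchIn r i ~? y))                          ≡⟨ orbit-size (punchIn r i) ⟩
    ℓ (punchIn r i)                                           ∎
    where open ≡-Reasoning

  module _ {i} (r≁i : ¬ r ~ punchIn r i) where

    ℓ-∖-away : D.ℓ i ≡ ℓ (punchIn r i)
    ℓ-∖-away = trans (sym (+-identityʳ _)) (trans (cong (D.ℓ i +_) (sym (𝟙-no (r≁i ∘ ~-sym) _))) (ℓ-∖ i))

    isRep-∖-away : D.isRep i ≡ isRep (punchIn r i)
    isRep-∖-away = 𝟙-cong to from _ _
      where
      to : IsCycleRep ((σ ∖ r) ⟨$⟩ʳ_) i → IsCycleRep (σ ⟨$⟩ʳ_) (punchIn r i)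
      to rep = minimal⇒IsCycleRep λ {y} i~y → lemma i~y (y ≟ r)
        where
        lemma : ∀ {y} → punchIn r i ~ y → Dec (y ≡ r) → toℕ (punchIn r i) ≤ toℕ y
        lemma i~y (yes refl) = ⊥-elim (r≁i (~-sym i~y))
        lemma i~y (no y≢r) with punchIn-onto y≢r
        ... | j , refl = punchIn-mono-≤ r i j (D.IsCycleRep⇒minimal rep (~⇒~∖ i~y))
      from : IsCycleRep (σ ⟨$⟩ʳ_) (punchIn r i) → IsCycleRep ((σ ∖ r) ⟨$⟩ʳ_) i
      from rep = D.minimal⇒IsCycleRep λ {j} i~j → punchIn-cancel-≤ r i j (IsCycleRep⇒minimal rep (~∖⇒~ i~j))

    oddRep-∖-away : D.oddRep i ≡ oddRep (punchIn r i)
    oddRep-∖-away = cong₂ (λ a n → a * parity n) isRep-∖-away ℓ-∖-away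

  oddCyclesAvoiding-∖ : oddCyclesAvoiding r ≡ sum (λ i → 𝟙 (¬? (r ~? punchIn r i)) * D.oddRep i)
  oddCyclesAvoiding-∖ = trans (sum-remove {i = r} (λ y → 𝟙 (¬? (r ~? y)) * oddRep y))
                              (cong₂ _+_ (cong (_* oddRep r) (𝟙-no (λ ¬r~r → ¬r~r ~-refl) (¬? (r ~? r))))
                                         (sum-cong-≗ away))
    where
    away : ∀ i → 𝟙 (¬? (r ~? punchIn r i)) * oddRep (punchIn r i) ≡ 𝟙 (¬? (r ~? punchIn r i)) * D.oddRep i
    away i with r ~? punchIn r i
    ... | yes _   = refl
    ... | no  r≁i = cong (1 *_) (sym (oddRep-∖-away r≁i))

  oddCycles-∖-fixed : σ ⟨$⟩ʳ r ≡ r → oddCycles σ + parity (suc (ℓ r)) ≡ oddCycles (σ ∖ r) + parity (ℓ r)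
  oddCycles-∖-fixed σr≡r = begin
    oddCycles σ + parity (suc (ℓ r))      ≡⟨ cong₂ _+_ (oddCycles-split r) (cong (parity ∘ suc) (ℓ-fixed σr≡r)) ⟩
    parity (ℓ r) + A + 0                  ≡⟨ cong (λ n → parity n + A + 0) (ℓ-fixed σr≡r) ⟩
    1 + A + 0                             ≡⟨ trans (+-identityʳ _) (+-comm 1 A) ⟩
    A + 1                                 ≡⟨ cong₂ _+_ (sym c∖) (cong parity (sym (ℓ-fixed σr≡r))) ⟩
    oddCycles (σ ∖ r) + parity (ℓ r)      ∎
    where
    open ≡-Reasoning
    A = oddCyclesAvoiding r
    unreachable : ∀ i → ¬ r ~ punchIn r i
    unreachable i (k , σᵏr≡Li) = punchInᵢ≢i r i (trans (sym σᵏr≡Li) (iter-fixed (σ ⟨$⟩ʳ_) σr≡r k))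
    c∖ : oddCycles (σ ∖ r) ≡ A
    c∖ = trans D.oddCycles-sum (trans (sum-cong-≗ λ i → trans (sym (*-identityˡ _))
                  (cong (_* D.oddRep i) (sym (𝟙-yes (unreachable i) (¬? (r ~? punchIn r i))))))
               (sym oddCyclesAvoiding-∖))

  oddCycles-∖-moved : ∀ {i₀} → punchIn r i₀ ≡ σ ⟨$⟩ʳ r →
                      oddCycles σ + parity (suc (ℓ r)) ≡ oddCycles (σ ∖ r) + parity (ℓ r)
  oddCycles-∖-moved {i₀} i₀↦σr = begin
    oddCycles σ + parity (suc (ℓ r))      ≡⟨ cong (_+ parity (suc (ℓ r))) (oddCycles-split r) ⟩
    parity (ℓ r) + A + parity (suc (ℓ r)) ≡⟨ cong (λ n → parity n + A + parity (suc n)) ℓr≡1+t ⟩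
    parity (suc t) + A + parity t         ≡⟨ xy∙z≈zy∙x (parity (suc t)) A (parity t) ⟩
    parity t + A + parity (suc t)         ≡⟨ cong₂ _+_ (sym c∖) (cong parity (sym ℓr≡1+t)) ⟩
    oddCycles (σ ∖ r) + parity (ℓ r)      ∎
    where
    open ≡-Reasoning
    A = oddCyclesAvoiding r
    t = D.ℓ i₀
    r~i₀ : r ~ punchIn r i₀
    r~i₀ = 1 , sym i₀↦σr
    r~ : ∀ {i} → r ~ punchIn r i → i₀ D.~ i
    r~ r~i = ~⇒~∖ (~-trans (~-sym r~i₀) r~i)
    ~r : ∀ {i} → i₀ D.~ i → r ~ punchIn r i
    ~r i₀~i = ~-trans r~i₀ (~∖⇒~ i₀~i)
    ℓr≡1+t : ℓ r ≡ suc t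
    ℓr≡1+t = begin
      ℓ r                              ≡⟨ ℓ-cong r~i₀ ⟩
      ℓ (punchIn r i₀)                 ≡⟨ ℓ-∖ i₀ ⟨
      t + 𝟙 (punchIn r i₀ ~? r)        ≡⟨ cong (t +_) (𝟙-yes (~-sym r~i₀) _) ⟩
      t + 1                            ≡⟨ +-comm t 1 ⟩
      suc t                            ∎
    c∖ : oddCycles (σ ∖ r) ≡ parity t + A
    c∖ = trans (D.oddCycles-split i₀) (cong (parity t +_) (trans
           (sum-cong-≗ λ i → cong (_* D.oddRep i) (𝟙-cong (λ ¬i₀~i → ¬i₀~i ∘ r~) (λ ¬r~i → ¬r~i ∘ ~r)
                                                             (¬? (i₀ D.~? i)) (¬? (r ~? punchIn r i))))
           (sym oddCyclesAvoiding-∖)))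

  oddCycles-∖ : ∀ {n} → ℓ r ≡ n → oddCycles σ + parity (suc n) ≡ oddCycles (σ ∖ r) + parity n
  oddCycles-∖ refl = cases (σ ⟨$⟩ʳ r ≟ r)
    where
    cases : Dec (σ ⟨$⟩ʳ r ≡ r) → oddCycles σ + parity (suc (ℓ r)) ≡ oddCycles (σ ∖ r) + parity (ℓ r)
    cases (yes σr≡r) = oddCycles-∖-fixed σr≡r
    cases (no  σr≢r) = oddCycles-∖-moved (proj₂ (punchIn-onto σr≢r))


oddCycles-lift₀ : ∀ (ρ : Permutation′ m) → oddCycles (lift₀ ρ) ≡ suc (oddCycles ρ)
oddCycles-lift₀ ρ = begin
  oddCycles (lift₀ ρ)              ≡⟨ +-identityʳ _ ⟨
  oddCycles (lift₀ ρ) + 0          ≡⟨ Deletion.oddCycles-∖ (lift₀ ρ) zero (Cycles.ℓ-fixed (lift₀ ρ) {zero} refl) ⟩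
  oddCycles (lift₀ ρ ∖ zero) + 1   ≡⟨ cong (_+ 1) (cOdd-cong ∖0≗ρ) ⟩
  oddCycles ρ + 1                  ≡⟨ +-comm (oddCycles ρ) 1 ⟩
  suc (oddCycles ρ)                ∎
  where
  open ≡-Reasoning
  ∖0≗ρ : lift₀ ρ ∖ zero ≈ ρ
  ∖0≗ρ i with ∖-view (lift₀ ρ) zero i
  ... | hits-r () _
  ... | misses-r _ step = Finₚ.suc-injective step

module _ {m} (σ : Permutation′ m) where

  private
    module C = Cycles σ
    module F = Cycles (flip σ)

  iter-flip : ∀ k x → iter (flip σ ⟨$⟩ʳ_) k (iter (σ ⟨$⟩ʳ_) k x) ≡ x
  iter-flip zero    x = refl
  iter-flip (suc k) x = trans (iter-sucʳ (flip σ ⟨$⟩ʳ_) k _)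
                              (trans (cong (iter (flip σ ⟨$⟩ʳ_) k) (inverseˡ σ)) (iter-flip k x))

  iter-flip-fixed : ∀ {k x} → iter (σ ⟨$⟩ʳ_) k x ≡ x → iter (flip σ ⟨$⟩ʳ_) k x ≡ x
  iter-flip-fixed {k} {x} σᵏx≡x = trans (cong (iter (flip σ ⟨$⟩ʳ_) k) (sym σᵏx≡x)) (iter-flip k x)

  ~⇒~flip : ∀ {x y} → x C.~ y → x F.~ y
  ~⇒~flip x~y with C.~-sym x~y
  ... | k , refl = k , iter-flip k _

ℓ-flip : ∀ (σ : Permutation′ m) x → Cycles.ℓ (flip σ) x ≡ Cycles.ℓ σ x
ℓ-flip σ x = F.ℓ-unique x (C.ℓ-positive x) (iter-flip-fixed σ {C.ℓ x} (C.iter-ℓ x))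
                        (λ {i} 1≤i i<ℓ σ⁻ⁱx≡x → C.ℓ-minimal x 1≤i i<ℓ (iter-flip-fixed (flip σ) {i} σ⁻ⁱx≡x))
  where
  module C = Cycles σ
  module F = Cycles (flip σ)

oddCycles-flip : ∀ (σ : Permutation′ m) → oddCycles (flip σ) ≡ oddCycles σ
oddCycles-flip σ = trans F.oddCycles-sum (trans (sum-cong-≗ λ x → cong₂ (λ a n → a * parity n)
                     (𝟙-cong (λ rep → C.minimal⇒IsCycleRep (F.IsCycleRep⇒minimal rep ∘ ~⇒~flip σ))
                             (λ rep → F.minimal⇒IsCycleRep (C.IsCycleRep⇒minimal rep ∘ ~⇒~flip (flip σ)))
                             (isCycleRep? (flip σ ⟨$⟩ʳ_) x) (isCycleRep? (σ ⟨$⟩ʳ_) x))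
                     (ℓ-flip σ x))
                   (sym C.oddCycles-sum))
  where
  module C = Cycles σ
  module F = Cycles (flip σ)

module _ {m} (h σ : Permutation′ m) where

  iter-conj : ∀ k x → iter ((flip h ∘ₚ σ ∘ₚ h) ⟨$⟩ʳ_) k (h ⟨$⟩ʳ x) ≡ h ⟨$⟩ʳ iter (σ ⟨$⟩ʳ_) k x
  iter-conj zero    x = refl
  iter-conj (suc k) x = trans (cong ((flip h ∘ₚ σ ∘ₚ h) ⟨$⟩ʳ_) (iter-conj k x))
                              (cong (λ y → h ⟨$⟩ʳ (σ ⟨$⟩ʳ y)) (inverseˡ h))

  ℓ-conj : ∀ x → Cycles.ℓ (flip h ∘ₚ σ ∘ₚ h) (h ⟨$⟩ʳ x) ≡ Cycles.ℓ σ x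
  ℓ-conj x = Cycles.ℓ-unique (flip h ∘ₚ σ ∘ₚ h) (h ⟨$⟩ʳ x) (C.ℓ-positive x)
               (trans (iter-conj (C.ℓ x) x) (cong (h ⟨$⟩ʳ_) (C.iter-ℓ x)))
               (λ {i} 1≤i i<ℓ e → C.ℓ-minimal x 1≤i i<ℓ (⟨$⟩ʳ-injective h (trans (sym (iter-conj i x)) e)))
    where module C = Cycles σ

∖-conj : ∀ (h σ : Permutation′ (suc m)) r →
         (flip h ∘ₚ σ ∘ₚ h) ∖ (h ⟨$⟩ʳ r) ≈ flip (remove r h) ∘ₚ (σ ∖ r) ∘ₚ remove r h
∖-conj h σ r i = punchIn-injective (h ⟨$⟩ʳ r) _ _
  (trans (cases (∖-view τ (h ⟨$⟩ʳ r) i) (∖-view σ r z)) (punchIn-permute h r ((σ ∖ r) ⟨$⟩ʳ z)))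
  where
  τ = flip h ∘ₚ σ ∘ₚ h
  z = remove r h ⟨$⟩ˡ i
  z↦i : punchIn r z ≡ h ⟨$⟩ˡ punchIn (h ⟨$⟩ʳ r) i
  z↦i = trans (sym (inverseˡ h)) (cong (h ⟨$⟩ˡ_)
          (trans (punchIn-permute h r z) (cong (punchIn (h ⟨$⟩ʳ r)) (inverseʳ (remove r h)))))
  τi≡hσz : τ ⟨$⟩ʳ punchIn (h ⟨$⟩ʳ r) i ≡ h ⟨$⟩ʳ (σ ⟨$⟩ʳ punchIn r z)
  τi≡hσz = cong (λ y → h ⟨$⟩ʳ (σ ⟨$⟩ʳ y)) (sym z↦i)
  cases : ∖-View τ (h ⟨$⟩ʳ r) i → ∖-View σ r z →
          punchIn (h ⟨$⟩ʳ r) ((τ ∖ (h ⟨$⟩ʳ r)) ⟨$⟩ʳ i) ≡ h ⟨$⟩ʳ punchIn r ((σ ∖ r) ⟨$⟩ʳ z)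
  cases (hits-r _ step) (hits-r _ step′) =
    trans step (trans (cong (λ y → h ⟨$⟩ʳ (σ ⟨$⟩ʳ y)) (inverseˡ h)) (cong (h ⟨$⟩ʳ_) (sym step′)))
  cases (hits-r τi≡hr _) (misses-r σz≢r _) = ⊥-elim (σz≢r (⟨$⟩ʳ-injective h (trans (sym τi≡hσz) τi≡hr)))
  cases (misses-r τi≢hr _) (hits-r σz≡r _) = ⊥-elim (τi≢hr (trans τi≡hσz (cong (h ⟨$⟩ʳ_) σz≡r)))
  cases (misses-r _ step) (misses-r _ step′) = trans step (trans τi≡hσz (cong (h ⟨$⟩ʳ_) (sym step′)))

oddCycles-conj : ∀ (h σ : Permutation′ m) → oddCycles (flip h ∘ₚ σ ∘ₚ h) ≡ oddCycles σ
oddCycles-conj {zero}  h σ = refl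
oddCycles-conj {suc m} h σ = +-cancelʳ-≡ (parity (suc t)) _ _ (begin
  oddCycles τ + parity (suc t)          ≡⟨ Deletion.oddCycles-∖ τ (h ⟨$⟩ʳ zero) (ℓ-conj h σ zero) ⟩
  oddCycles (τ ∖ (h ⟨$⟩ʳ zero)) + parity t
    ≡⟨ cong (_+ parity t) (trans (cOdd-cong (∖-conj h σ zero)) (oddCycles-conj (remove zero h) (σ ∖ zero))) ⟩
  oddCycles (σ ∖ zero) + parity t       ≡⟨ Deletion.oddCycles-∖ σ zero refl ⟨
  oddCycles σ + parity (suc t)          ∎)
  where
  open ≡-Reasoning
  τ = flip h ∘ₚ σ ∘ₚ h
  t = Cycles.ℓ σ zero


-- Composing with a transposition

-- σ ∘ₚ τ applies σ first, so transpose p q ∘ₚ σ is σ ∘ (p q) in the paper's notation.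
record Merge {m} (σ : Permutation′ m) (p q : Fin m) : Set where
  field
    joined           : p ~[ transpose p q ∘ₚ σ ] q
    ℓ-joined         : Cycles.ℓ (transpose p q ∘ₚ σ) p ≡ Cycles.ℓ σ p + Cycles.ℓ σ q
    oddCycles-joined : oddCycles (transpose p q ∘ₚ σ) + parity (Cycles.ℓ σ p) + parity (Cycles.ℓ σ q)
                       ≡ oddCycles σ + parity (Cycles.ℓ σ p + Cycles.ℓ σ q)

record TransposeLaw {m} (σ : Permutation′ m) (p q : Fin m) : Set where
  field
    split : p ~[ σ ] q → ¬ p ~[ transpose p q ∘ₚ σ ] q
    merge : ¬ p ~[ σ ] q → Merge σ p q

-- Combines the deletion identities for σ and σ ∘ (p q) with the merge identity after deletion.
+-cancel-chain : ∀ {a a′ c c′ x x̄ y z z̄} → a + x ≡ a′ + x̄ → c + z ≡ c′ + z̄ → c′ + x + y ≡ a′ + z →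
                 c + x̄ + y ≡ a + z̄
+-cancel-chain {a} {a′} {c} {c′} {x} {x̄} {y} {z} {z̄} ax≡a′x̄ cz≡c′z̄ c′xy≡a′z =
  +-cancelʳ-≡ (x + z) _ _ (begin
  c + x̄ + y + (x + z)       ≡⟨ shuffle₁ c x̄ y x z ⟩
  (c + z) + (x̄ + x + y)     ≡⟨ cong (_+ (x̄ + x + y)) cz≡c′z̄ ⟩
  (c′ + z̄) + (x̄ + x + y)    ≡⟨ shuffle₂ c′ z̄ x̄ x y ⟩
  (c′ + x + y) + (x̄ + z̄)    ≡⟨ cong (_+ (x̄ + z̄)) c′xy≡a′z ⟩
  (a′ + z) + (x̄ + z̄)        ≡⟨ shuffle₃ a′ z x̄ z̄ ⟩
  (a′ + x̄) + (z + z̄)        ≡⟨ cong (_+ (z + z̄)) ax≡a′x̄ ⟨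
  (a + x) + (z + z̄)         ≡⟨ shuffle₄ a x z z̄ ⟩
  a + z̄ + (x + z)           ∎)
  where
  open ≡-Reasoning
  shuffle₁ : ∀ c x̄ y x z → c + x̄ + y + (x + z) ≡ (c + z) + (x̄ + x + y)
  shuffle₁ = solve-∀
  shuffle₂ : ∀ c′ z̄ x̄ x y → (c′ + z̄) + (x̄ + x + y) ≡ (c′ + x + y) + (x̄ + z̄)
  shuffle₂ = solve-∀
  shuffle₃ : ∀ a′ z x̄ z̄ → (a′ + z) + (x̄ + z̄) ≡ (a′ + x̄) + (z + z̄)
  shuffle₃ = solve-∀
  shuffle₄ : ∀ a x z z̄ → (a + x) + (z + z̄) ≡ a + z̄ + (x + z)
  shuffle₄ = solve-∀

module TransposeStep {m} (σ : Permutation′ (suc m)) (r : Fin (suc m)) (p′ q′ : Fin m) where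

  private
    p = punchIn r p′
    q = punchIn r q′
    τ = transpose p q ∘ₚ σ
    τ′ = transpose p′ q′ ∘ₚ (σ ∖ r)
    module S  = Cycles σ
    module T  = Cycles τ
    module S′ = Cycles (σ ∖ r)
    module DS = Deletion σ r
    module DT = Deletion τ r

  τr≡σr : τ ⟨$⟩ʳ r ≡ σ ⟨$⟩ʳ r
  τr≡σr = cong (σ ⟨$⟩ʳ_) (transpose-other (punchInᵢ≢i r p′ ∘ sym) (punchInᵢ≢i r q′ ∘ sym))

  ∖-transpose : τ ∖ r ≈ τ′
  ∖-transpose i = punchIn-injective r _ _ (cases (∖-view τ r i) (∖-view σ r (transpose p′ q′ ⟨$⟩ʳ i)))
    where
    τi≡σj : τ ⟨$⟩ʳ punchIn r i ≡ σ ⟨$⟩ʳ punchIn r (transpose p′ q′ ⟨$⟩ʳ i)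
    τi≡σj = cong (σ ⟨$⟩ʳ_) (sym (punchIn-transpose r p′ q′ i))
    cases : ∖-View τ r i → ∖-View σ r (transpose p′ q′ ⟨$⟩ʳ i) →
            punchIn r ((τ ∖ r) ⟨$⟩ʳ i) ≡ punchIn r ((σ ∖ r) ⟨$⟩ʳ (transpose p′ q′ ⟨$⟩ʳ i))
    cases (hits-r _ step)   (hits-r _ step′)   = trans step (trans τr≡σr (sym step′))
    cases (hits-r τi≡r _)   (misses-r σj≢r _)  = ⊥-elim (σj≢r (trans (sym τi≡σj) τi≡r))
    cases (misses-r τi≢r _) (hits-r σj≡r _)    = ⊥-elim (τi≢r (trans τi≡σj σj≡r))
    cases (misses-r _ step) (misses-r _ step′) = trans step (trans τi≡σj (sym step′))

  transposeLaw-step : σ ⟨$⟩ʳ r ≡ punchIn r p′ → TransposeLaw (σ ∖ r) p′ q′ →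
                      TransposeLaw σ (punchIn r p′) (punchIn r q′)
  transposeLaw-step σr≡p IH = record
    { split = λ p~q τp~q → IH.split (DS.~⇒~∖ p~q) (~-resp-≈ {σ = τ ∖ r} {τ′} ∖-transpose (DT.~⇒~∖ τp~q))
    ; merge = merge
    }
    where
    module IH = TransposeLaw IH
    merge : ¬ p ~[ σ ] q → Merge σ p q
    merge p≁q = record { joined = joined ; ℓ-joined = ℓ-joined ; oddCycles-joined = oddCycles-joined }
      where
      open Merge (IH.merge (p≁q ∘ DS.~∖⇒~)) renaming
        (joined to joined′; ℓ-joined to ℓ-joined′; oddCycles-joined to oddCycles-joined′)
      a′ = S′.ℓ p′
      b  = S′.ℓ q′
      r~p : r ~[ σ ] p
      r~p = 1 , σr≡p
      r~τp : r ~[ τ ] p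
      r~τp = 1 , trans τr≡σr σr≡p
      r≁q : ¬ r ~[ σ ] q
      r≁q r~q = p≁q (S.~-trans (S.~-sym r~p) r~q)
      joined : p ~[ τ ] q
      joined = DT.~∖⇒~ (~-resp-≈ {σ = τ′} {τ ∖ r} (sym ∘ ∖-transpose) joined′)
      ℓp≡1+a′ : S.ℓ p ≡ suc a′
      ℓp≡1+a′ = trans (sym (DS.ℓ-∖ p′))
                      (trans (cong (a′ +_) (𝟙-yes (S.~-sym r~p) (p S.~? r))) (+-comm a′ 1))
      ℓq≡b : S.ℓ q ≡ b
      ℓq≡b = sym (DS.ℓ-∖-away r≁q)
      ℓτp≡1+a′+b : T.ℓ p ≡ suc (a′ + b)
      ℓτp≡1+a′+b = trans (sym (DT.ℓ-∖ p′))
        (trans (cong₂ _+_ (trans (ℓ-resp-≈ {σ = τ ∖ r} {τ′} ∖-transpose p′) ℓ-joined′)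
                          (𝟙-yes (T.~-sym r~τp) (p T.~? r)))
               (+-comm (a′ + b) 1))
      ℓ-joined : T.ℓ p ≡ S.ℓ p + S.ℓ q
      ℓ-joined = trans ℓτp≡1+a′+b (sym (cong₂ _+_ ℓp≡1+a′ ℓq≡b))
      oddCycles-joined : oddCycles τ + parity (S.ℓ p) + parity (S.ℓ q) ≡ oddCycles σ + parity (S.ℓ p + S.ℓ q)
      oddCycles-joined = subst₂ (λ u v → oddCycles τ + parity u + parity v ≡ oddCycles σ + parity (u + v))
        (sym ℓp≡1+a′) (sym ℓq≡b)
        (+-cancel-chain {oddCycles σ} {oddCycles (σ ∖ r)} {oddCycles τ} {oddCycles (τ ∖ r)}
                        {parity a′} {parity (suc a′)} {parity b} {parity (a′ + b)} {parity (suc (a′ + b))}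
          (DS.oddCycles-∖ (trans (S.ℓ-cong r~p) ℓp≡1+a′))
          (DT.oddCycles-∖ (trans (T.ℓ-cong r~τp) ℓτp≡1+a′+b))
          (trans (cong (λ c → c + parity a′ + parity b) (cOdd-cong ∖-transpose)) oddCycles-joined′))

transposeLaw-sym : ∀ {m} {σ : Permutation′ m} {p q} → TransposeLaw σ q p → TransposeLaw σ p q
transposeLaw-sym {σ = σ} {p} {q} law = record
  { split = λ p~q p~τq → L.split (S.~-sym p~q) (~-resp-≈ {σ = τ} {τ′} (sym ∘ swap≈) (T.~-sym p~τq))
  ; merge = merge
  }
  where
  τ  = transpose p q ∘ₚ σ
  τ′ = transpose q p ∘ₚ σ
  module L = TransposeLaw law
  module S = Cycles σ
  module T = Cycles τ
  swap≈ : τ′ ≈ τ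
  swap≈ y = cong (σ ⟨$⟩ʳ_) (transpose-comm q p y)
  merge : ¬ p ~[ σ ] q → Merge σ p q
  merge p≁q = record
    { joined   = T.~-sym q~p
    ; ℓ-joined = begin
        T.ℓ p                   ≡⟨ T.ℓ-cong q~p ⟨
        T.ℓ q                   ≡⟨ ℓ-resp-≈ {σ = τ′} {τ} swap≈ q ⟨
        Cycles.ℓ τ′ q           ≡⟨ M.ℓ-joined ⟩
        S.ℓ q + S.ℓ p           ≡⟨ +-comm (S.ℓ q) (S.ℓ p) ⟩
        S.ℓ p + S.ℓ q           ∎
    ; oddCycles-joined = begin
        oddCycles τ + parity (S.ℓ p) + parity (S.ℓ q)   ≡⟨ xy∙z≈xz∙y (oddCycles τ) (parity (S.ℓ p)) (parity (S.ℓ q)) ⟩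
        oddCycles τ + parity (S.ℓ q) + parity (S.ℓ p)   ≡⟨ cong (λ c → c + parity (S.ℓ q) + parity (S.ℓ p)) (cOdd-cong swap≈) ⟨
        oddCycles τ′ + parity (S.ℓ q) + parity (S.ℓ p)  ≡⟨ M.oddCycles-joined ⟩
        oddCycles σ + parity (S.ℓ q + S.ℓ p)
          ≡⟨ cong (λ n → oddCycles σ + parity n) (+-comm (S.ℓ q) (S.ℓ p)) ⟩
        oddCycles σ + parity (S.ℓ p + S.ℓ q) ∎
    }
    where
    open ≡-Reasoning
    module M = Merge (L.merge (p≁q ∘ S.~-sym))
    q~p : q ~[ τ ] p
    q~p = ~-resp-≈ {σ = τ′} {τ} swap≈ M.joined

transposeLaw-swapped : ∀ {m} {σ : Permutation′ m} {p q} → p ≢ q →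
                       σ ⟨$⟩ʳ p ≡ q → σ ⟨$⟩ʳ q ≡ p → TransposeLaw σ p q
transposeLaw-swapped {σ = σ} {p} {q} p≢q σp≡q σq≡p = record
  { split = λ _ (k , τᵏp≡q) → p≢q (trans (sym (iter-fixed _ τp≡p k)) τᵏp≡q)
  ; merge = λ p≁q → ⊥-elim (p≁q (1 , σp≡q))
  }
  where
  τp≡p : (transpose p q ∘ₚ σ) ⟨$⟩ʳ p ≡ p
  τp≡p = trans (cong (σ ⟨$⟩ʳ_) (transpose-i p q)) σq≡p

transposeLaw-fixed : ∀ {m} {σ : Permutation′ (suc m)} {p q} → p ≢ q →
                     σ ⟨$⟩ʳ p ≡ p → σ ⟨$⟩ʳ q ≡ q → TransposeLaw σ p q
transposeLaw-fixed {σ = σ} {p} {q} p≢q σp≡p σq≡q = record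
  { split = λ (k , σᵏp≡q) → ⊥-elim (p≢q (trans (sym (iter-fixed _ σp≡p k)) σᵏp≡q))
  ; merge = λ _ → record { joined = 1 , τp≡q ; ℓ-joined = ℓ-joined ; oddCycles-joined = oddCycles-joined }
  }
  where
  τ = transpose p q ∘ₚ σ
  module S = Cycles σ
  module T = Cycles τ
  τp≡q : τ ⟨$⟩ʳ p ≡ q
  τp≡q = trans (cong (σ ⟨$⟩ʳ_) (transpose-i p q)) σq≡q
  τq≡p : τ ⟨$⟩ʳ q ≡ p
  τq≡p = trans (cong (σ ⟨$⟩ʳ_) (transpose-j p q)) σp≡p
  ℓτp≡2 : T.ℓ p ≡ 2
  ℓτp≡2 = T.ℓ-unique p (s≤s z≤n) (trans (cong (τ ⟨$⟩ʳ_) τp≡q) τq≡p) minimal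
    where
    minimal : ∀ {i} → 1 ≤ i → i < 2 → iter (τ ⟨$⟩ʳ_) i p ≢ p
    minimal {1} _ _ τp≡p = p≢q (trans (sym τp≡p) τp≡q)
    minimal {suc (suc _)} _ (s≤s (s≤s ()))
  ℓ-joined : T.ℓ p ≡ S.ℓ p + S.ℓ q
  ℓ-joined = trans ℓτp≡2 (sym (cong₂ _+_ (S.ℓ-fixed σp≡p) (S.ℓ-fixed σq≡q)))
  τ∖p≈σ∖p : τ ∖ p ≈ σ ∖ p
  τ∖p≈σ∖p i = punchIn-injective p _ _ (cases (∖-view τ p i) (∖-view σ p i) (punchIn p i ≟ q))
    where
    cases : ∖-View τ p i → ∖-View σ p i → Dec (punchIn p i ≡ q) →
            punchIn p ((τ ∖ p) ⟨$⟩ʳ i) ≡ punchIn p ((σ ∖ p) ⟨$⟩ʳ i)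
    cases _ (hits-r σi≡p _) _ = ⊥-elim (punchInᵢ≢i p i (⟨$⟩ʳ-injective σ (trans σi≡p (sym σp≡p))))
    cases (hits-r _ step) (misses-r _ step′) (yes i≡q) =
      trans step (trans τp≡q (trans (sym σq≡q) (trans (cong (σ ⟨$⟩ʳ_) (sym i≡q)) (sym step′))))
    cases (hits-r τi≡p _) (misses-r _ _) (no i≢q) = ⊥-elim (punchInᵢ≢i p i (⟨$⟩ʳ-injective σ
      (trans (cong (σ ⟨$⟩ʳ_) (sym (transpose-other (punchInᵢ≢i p i) i≢q))) (trans τi≡p (sym σp≡p)))))
    cases (misses-r τi≢p _) (misses-r _ _) (yes refl) = ⊥-elim (τi≢p τq≡p)
    cases (misses-r _ step) (misses-r _ step′) (no i≢q) =
      trans step (trans (cong (σ ⟨$⟩ʳ_) (transpose-other (punchInᵢ≢i p i) i≢q)) (sym step′))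
  oddCycles-joined : oddCycles τ + parity (S.ℓ p) + parity (S.ℓ q) ≡ oddCycles σ + parity (S.ℓ p + S.ℓ q)
  oddCycles-joined = subst₂ (λ u v → oddCycles τ + parity u + parity v ≡ oddCycles σ + parity (u + v))
    (sym (S.ℓ-fixed σp≡p)) (sym (S.ℓ-fixed σq≡q)) (begin
      oddCycles τ + 1 + 1           ≡⟨ cong (_+ 1) (Deletion.oddCycles-∖ τ p ℓτp≡2) ⟩
      oddCycles (τ ∖ p) + 0 + 1     ≡⟨ cong (λ c → c + 0 + 1) (cOdd-cong τ∖p≈σ∖p) ⟩
      oddCycles (σ ∖ p) + 0 + 1     ≡⟨ cong (_+ 1) (+-identityʳ _) ⟩
      oddCycles (σ ∖ p) + 1         ≡⟨ Deletion.oddCycles-∖ σ p (S.ℓ-fixed σp≡p) ⟨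
      oddCycles σ + 0               ∎)
    where open ≡-Reasoning

-- Induction on m, deleting the predecessor of p or of q; when neither lies outside {p, q},
-- σ fixes both points or swaps them.
transposeLaw : ∀ {m} (σ : Permutation′ m) {p q} → p ≢ q → TransposeLaw σ p q
transposeLaw {zero}  σ {()}
transposeLaw {suc m} σ {p} {q} p≢q =
  cases (σ ⟨$⟩ˡ p ≟ p) (σ ⟨$⟩ˡ p ≟ q) (σ ⟨$⟩ˡ q ≟ p) (σ ⟨$⟩ˡ q ≟ q)
  where
  σ⟨$⟩ʳ : ∀ {x y} → σ ⟨$⟩ˡ x ≡ y → σ ⟨$⟩ʳ y ≡ x
  σ⟨$⟩ʳ {x} refl = inverseʳ σ
  viaPredecessor : ∀ {x y} → x ≢ y → σ ⟨$⟩ˡ x ≢ x → σ ⟨$⟩ˡ x ≢ y → TransposeLaw σ x y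
  viaPredecessor {x} {y} x≢y r≢x r≢y = step (punchIn-onto (r≢x ∘ sym)) (punchIn-onto (r≢y ∘ sym))
    where
    r = σ ⟨$⟩ˡ x
    step : (∃[ x′ ] punchIn r x′ ≡ x) → (∃[ y′ ] punchIn r y′ ≡ y) → TransposeLaw σ x y
    step (x′ , x′↦x) (y′ , y′↦y) = subst₂ (TransposeLaw σ) x′↦x y′↦y
      (TransposeStep.transposeLaw-step σ r x′ y′ (trans (inverseʳ σ) (sym x′↦x))
                                                   (transposeLaw (σ ∖ r) x′≢y′))
      where
      x′≢y′ : x′ ≢ y′
      x′≢y′ x′≡y′ = x≢y (trans (sym x′↦x) (trans (cong (punchIn r) x′≡y′) y′↦y))
  cases : Dec (σ ⟨$⟩ˡ p ≡ p) → Dec (σ ⟨$⟩ˡ p ≡ q) → Dec (σ ⟨$⟩ˡ q ≡ p) → Dec (σ ⟨$⟩ˡ q ≡ q) →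
          TransposeLaw σ p q
  cases (no r≢p) (no r≢q) _ _   = viaPredecessor p≢q r≢p r≢q
  cases _ _ (no r≢p) (no r≢q)   = transposeLaw-sym (viaPredecessor (p≢q ∘ sym) r≢q r≢p)
  cases (yes p↤p) _ _ (yes q↤q) = transposeLaw-fixed p≢q (σ⟨$⟩ʳ p↤p) (σ⟨$⟩ʳ q↤q)
  cases _ (yes q↤p) (yes p↤q) _ = transposeLaw-swapped p≢q (σ⟨$⟩ʳ p↤q) (σ⟨$⟩ʳ q↤p)
  cases (yes p↤p) _ (yes p↤q) _ = ⊥-elim (p≢q (trans (sym (σ⟨$⟩ʳ p↤p)) (σ⟨$⟩ʳ p↤q)))
  cases _ (yes q↤p) _ (yes q↤q) = ⊥-elim (p≢q (trans (sym (σ⟨$⟩ʳ q↤p)) (σ⟨$⟩ʳ q↤q)))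

oddCycles-merge : ∀ (σ : Permutation′ m) {p q} → p ≢ q → ¬ p ~[ σ ] q →
                  oddCycles (transpose p q ∘ₚ σ) + 2 * (parity (Cycles.ℓ σ p) * parity (Cycles.ℓ σ q))
                  ≡ oddCycles σ
oddCycles-merge σ {p} {q} p≢q p≁q = +-cancelʳ-≡ (pp + pq) _ _ (begin
  oddCycles τ + 2 * (pp * pq) + (pp + pq)                ≡⟨ shuffle (oddCycles τ) (2 * (pp * pq)) pp pq ⟩
  oddCycles τ + pp + pq + 2 * (pp * pq)                  ≡⟨ cong (_+ 2 * (pp * pq)) (Merge.oddCycles-joined M) ⟩
  oddCycles σ + parity (S.ℓ p + S.ℓ q) + 2 * (pp * pq)   ≡⟨ +-assoc (oddCycles σ) _ _ ⟩
  oddCycles σ + (parity (S.ℓ p + S.ℓ q) + 2 * (pp * pq)) ≡⟨ cong (oddCycles σ +_) (parity-+ (S.ℓ p) (S.ℓ q)) ⟩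
  oddCycles σ + (pp + pq)                                ∎)
  where
  open ≡-Reasoning
  τ = transpose p q ∘ₚ σ
  module S = Cycles σ
  M = TransposeLaw.merge (transposeLaw σ p≢q) p≁q
  pp = parity (S.ℓ p)
  pq = parity (S.ℓ q)
  shuffle : ∀ c t a b → c + t + (a + b) ≡ c + a + b + t
  shuffle = solve-∀

module _ {m} (σ : Permutation′ m) {p q : Fin m} (p≢q : p ≢ q) where

  private
    τ = transpose p q ∘ₚ σ
    module S = Cycles σ

  oddCycles-split-≤ : p ~[ σ ] q → oddCycles σ ≤ oddCycles τ
  oddCycles-split-≤ p~q = begin
    oddCycles σ                                       ≡⟨ cOdd-cong transpose-cancel ⟨
    oddCycles (transpose p q ∘ₚ τ)                    ≤⟨ m≤m+n _ _ ⟩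
    oddCycles (transpose p q ∘ₚ τ) + 2 * (parity (T.ℓ p) * parity (T.ℓ q))
      ≡⟨ oddCycles-merge τ p≢q (TransposeLaw.split (transposeLaw σ p≢q) p~q) ⟩
    oddCycles τ                                       ∎
    where
    open ≤-Reasoning
    module T = Cycles τ
    transpose-cancel : transpose p q ∘ₚ τ ≈ σ
    transpose-cancel y = cong (σ ⟨$⟩ʳ_) (transpose-involutive p q y)

  oddCycles-transpose-≤ : oddCycles σ ≤ oddCycles τ + 2 * parity (S.ℓ q)
  oddCycles-transpose-≤ with p S.~? q
  ... | yes p~q = ≤-trans (oddCycles-split-≤ p~q) (m≤m+n _ _)
  ... | no  p≁q = begin
    oddCycles σ                                       ≡⟨ oddCycles-merge σ p≢q p≁q ⟨
    oddCycles τ + 2 * (parity (S.ℓ p) * parity (S.ℓ q))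
      ≤⟨ +-monoʳ-≤ (oddCycles τ) (*-monoʳ-≤ 2 pp*pq≤pq) ⟩
    oddCycles τ + 2 * parity (S.ℓ q)                  ∎
    where
    open ≤-Reasoning
    pp*pq≤pq : parity (S.ℓ p) * parity (S.ℓ q) ≤ parity (S.ℓ q)
    pp*pq≤pq = ≤-trans (*-monoˡ-≤ _ (parity≤1 (S.ℓ p))) (≤-reflexive (*-identityˡ _))

  oddCycles-transpose-≤2 : oddCycles σ ≤ oddCycles τ + 2
  oddCycles-transpose-≤2 =
    ≤-trans oddCycles-transpose-≤ (+-monoʳ-≤ (oddCycles τ) (*-monoʳ-≤ 2 (parity≤1 (S.ℓ q))))

oddCycles-3cycle-≤ : ∀ (σ : Permutation′ m) {u v x} → u ≢ v → x ≢ u →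
                     oddCycles σ ≤ oddCycles (transpose x u ∘ₚ transpose u v ∘ₚ σ) + 2
oddCycles-3cycle-≤ σ {u} {v} {x} u≢v x≢u with Cycles._~?_ σ u v
... | yes u~v = ≤-trans (oddCycles-split-≤ σ u≢v u~v) (oddCycles-transpose-≤2 (transpose u v ∘ₚ σ) x≢u)
... | no  u≁v = begin
  oddCycles σ                                   ≡⟨ oddCycles-merge σ u≢v u≁v ⟨
  oddCycles σ₁ + 2 * (pa * pb)                  ≤⟨ +-monoˡ-≤ (2 * (pa * pb)) (oddCycles-transpose-≤ σ₁ x≢u) ⟩
  oddCycles σ₂ + 2 * parity (Cycles.ℓ σ₁ u) + 2 * (pa * pb)
    ≡⟨ cong (λ n → oddCycles σ₂ + 2 * parity n + 2 * (pa * pb)) ℓ-joined ⟩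
  oddCycles σ₂ + 2 * parity (a + b) + 2 * (pa * pb)
    ≡⟨ trans (+-assoc (oddCycles σ₂) _ _)
             (cong (oddCycles σ₂ +_) (sym (*-distribˡ-+ 2 (parity (a + b)) (pa * pb)))) ⟩
  oddCycles σ₂ + 2 * (parity (a + b) + pa * pb) ≤⟨ +-monoʳ-≤ (oddCycles σ₂) (*-monoʳ-≤ 2 (parity-+-∧ a b)) ⟩
  oddCycles σ₂ + 2                              ∎
  where
  open ≤-Reasoning
  σ₁ = transpose u v ∘ₚ σ
  σ₂ = transpose x u ∘ₚ σ₁
  open Merge (TransposeLaw.merge (transposeLaw σ u≢v) u≁v) using (ℓ-joined)
  a = Cycles.ℓ σ u
  b = Cycles.ℓ σ v
  pa = parity a
  pb = parity b


-- Subadditivity of m minus the number of odd cycles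

module Peel {m} (b : Permutation′ m) {x} (bx≢x : b ⟨$⟩ʳ x ≢ x) where

  w : Fin m
  w = b ⟨$⟩ˡ x

  b₁ : Permutation′ m
  b₁ = transpose x w ∘ₚ b

  private
    module B  = Cycles b
    module B₁ = Cycles b₁

  bw≡x : b ⟨$⟩ʳ w ≡ x
  bw≡x = inverseʳ b

  x≢w : x ≢ w
  x≢w x≡w = bx≢x (trans (cong (b ⟨$⟩ʳ_) x≡w) bw≡x)

  b₁x≡x : b₁ ⟨$⟩ʳ x ≡ x
  b₁x≡x = trans (cong (b ⟨$⟩ʳ_) (transpose-i x w)) bw≡x

  b₁-fixes : ∀ {y} → b ⟨$⟩ʳ y ≡ y → b₁ ⟨$⟩ʳ y ≡ y
  b₁-fixes {y} by≡y = trans (cong (b ⟨$⟩ʳ_) (transpose-other y≢x y≢w)) by≡y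
    where
    y≢x : y ≢ x
    y≢x refl = bx≢x by≡y
    y≢w : y ≢ w
    y≢w refl = x≢w (trans (sym bw≡x) by≡y)

  restore : transpose x w ∘ₚ b₁ ≈ b
  restore y = cong (b ⟨$⟩ʳ_) (transpose-involutive x w y)

  x≁w : ¬ x ~[ b₁ ] w
  x≁w = TransposeLaw.split (transposeLaw b x≢w) (B.~-sym (1 , bw≡x))

  ℓ-peeled : B.ℓ x ≡ suc (B₁.ℓ w)
  ℓ-peeled = begin
    B.ℓ x                                   ≡⟨ ℓ-resp-≈ {σ = transpose x w ∘ₚ b₁} {b} restore x ⟨
    Cycles.ℓ (transpose x w ∘ₚ b₁) x        ≡⟨ Merge.ℓ-joined (TransposeLaw.merge (transposeLaw b₁ x≢w) x≁w) ⟩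
    B₁.ℓ x + B₁.ℓ w                         ≡⟨ cong (_+ B₁.ℓ w) (B₁.ℓ-fixed b₁x≡x) ⟩
    suc (B₁.ℓ w)                            ∎
    where open ≡-Reasoning

  oddCycles-peeled : oddCycles b + 2 * parity (B₁.ℓ w) ≡ oddCycles b₁
  oddCycles-peeled = begin
    oddCycles b + 2 * parity (B₁.ℓ w)
      ≡⟨ cong₂ (λ c n → c + 2 * n) (cOdd-cong restore) (*-identityˡ (parity (B₁.ℓ w))) ⟨
    oddCycles (transpose x w ∘ₚ b₁) + 2 * (1 * parity (B₁.ℓ w))
      ≡⟨ cong (λ n → oddCycles (transpose x w ∘ₚ b₁) + 2 * (parity n * parity (B₁.ℓ w))) (B₁.ℓ-fixed b₁x≡x) ⟨
    oddCycles (transpose x w ∘ₚ b₁) + 2 * (parity (B₁.ℓ x) * parity (B₁.ℓ w))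
      ≡⟨ oddCycles-merge b₁ x≢w x≁w ⟩
    oddCycles b₁                            ∎
    where open ≡-Reasoning

moved : Permutation′ m → ℕ
moved σ = sum (λ y → 𝟙 (¬? (σ ⟨$⟩ʳ y ≟ y)))

moved-< : ∀ {σ ρ : Permutation′ m} {x} → (∀ {y} → σ ⟨$⟩ʳ y ≡ y → ρ ⟨$⟩ʳ y ≡ y) →
          σ ⟨$⟩ʳ x ≢ x → ρ ⟨$⟩ʳ x ≡ x → moved ρ < moved σ
moved-< {suc m} {σ} {ρ} {x} keeps σx≢x ρx≡x = begin-strict
  moved ρ                                  ≡⟨ sum-remove {i = x} (λ y → 𝟙 (¬? (ρ ⟨$⟩ʳ y ≟ y))) ⟩
  𝟙 (¬? (ρ ⟨$⟩ʳ x ≟ x)) + rest ρ           ≡⟨ cong (_+ rest ρ) (𝟙-no (λ ρx≢x → ρx≢x ρx≡x) (¬? (ρ ⟨$⟩ʳ x ≟ x))) ⟩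
  rest ρ                                   <⟨ s≤s (sum-mono-≤ λ i → 𝟙-mono (λ ρy≢y σy≡y → ρy≢y (keeps σy≡y))
                                                (¬? (ρ ⟨$⟩ʳ punchIn x i ≟ punchIn x i))
                                                (¬? (σ ⟨$⟩ʳ punchIn x i ≟ punchIn x i))) ⟩
  1 + rest σ                               ≡⟨ cong (_+ rest σ) (𝟙-yes σx≢x (¬? (σ ⟨$⟩ʳ x ≟ x))) ⟨
  𝟙 (¬? (σ ⟨$⟩ʳ x ≟ x)) + rest σ           ≡⟨ sum-remove {i = x} (λ y → 𝟙 (¬? (σ ⟨$⟩ʳ y ≟ y))) ⟨
  moved σ                                  ∎
  where
  open ≤-Reasoning
  rest : Permutation′ (suc m) → ℕ
  rest π = sum (λ i → 𝟙 (¬? (π ⟨$⟩ʳ punchIn x i ≟ punchIn x i)))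

oddCycles-id : ∀ (σ : Permutation′ m) → (∀ y → σ ⟨$⟩ʳ y ≡ y) → oddCycles σ ≡ m
oddCycles-id {m} σ fixes = trans S.oddCycles-sum (trans (sum-cong-≗ single) (sum-1 m))
  where
  module S = Cycles σ
  single : ∀ x → S.oddRep x ≡ 1
  single x = cong₂ (λ a n → a * parity n)
    (𝟙-yes (S.minimal⇒IsCycleRep λ (k , σᵏx≡y) →
              ≤-reflexive (cong toℕ (trans (sym (iter-fixed _ (fixes x) k)) σᵏx≡y)))
           (isCycleRep? (σ ⟨$⟩ʳ_) x))
    (S.ℓ-fixed (fixes x))

record Reduction {m} (b : Permutation′ m) : Set where
  field
    reduct       : Permutation′ m
    fewer-moved  : moved reduct < moved b
    oddCycles-+2 : oddCycles reduct ≡ oddCycles b + 2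
    ∘ₚ-≤         : ∀ a → oddCycles (reduct ∘ₚ a) ≤ oddCycles (b ∘ₚ a) + 2

reduction : ∀ (b : Permutation′ m) {x} → b ⟨$⟩ʳ x ≢ x → Reduction b
reduction b {x} bx≢x = cases (parity≡0⊎1 (Cycles.ℓ P.b₁ P.w))
  where
  module P = Peel b bx≢x
  b₁-fewer : moved P.b₁ < moved b
  b₁-fewer = moved-< {σ = b} {P.b₁} P.b₁-fixes bx≢x P.b₁x≡x
  cases : parity (Cycles.ℓ P.b₁ P.w) ≡ 0 ⊎ parity (Cycles.ℓ P.b₁ P.w) ≡ 1 → Reduction b
  cases (inj₂ w-odd) = record
    { reduct       = P.b₁
    ; fewer-moved  = b₁-fewer
    ; oddCycles-+2 = trans (sym P.oddCycles-peeled) (cong (λ k → oddCycles b + 2 * k) w-odd)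
    ; ∘ₚ-≤         = λ a → ≤-trans (oddCycles-transpose-≤2 (P.b₁ ∘ₚ a) P.x≢w)
                             (≤-reflexive (cong (_+ 2) (cOdd-cong λ y → cong (a ⟨$⟩ʳ_) (P.restore y))))
    }
  -- The cycle of x has odd length, so peeling x leaves an even cycle through w to peel as well.
  cases (inj₁ w-even) = record
    { reduct       = Q.b₁
    ; fewer-moved  = <-trans (moved-< {σ = P.b₁} {Q.b₁} Q.b₁-fixes b₁w≢w Q.b₁x≡x) b₁-fewer
    ; oddCycles-+2 = begin
        oddCycles Q.b₁                                  ≡⟨ Q.oddCycles-peeled ⟨
        oddCycles P.b₁ + 2 * parity (Cycles.ℓ Q.b₁ Q.w) ≡⟨ cong₂ (λ c k → c + 2 * k) b₁-same w′-odd ⟩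
        oddCycles b + 2                                 ∎
    ; ∘ₚ-≤         = λ a → ≤-trans (oddCycles-3cycle-≤ (Q.b₁ ∘ₚ a) Q.x≢w P.x≢w)
                             (≤-reflexive (cong (_+ 2) (cOdd-cong λ y → cong (a ⟨$⟩ʳ_)
                               (trans (Q.restore (transpose x P.w ⟨$⟩ʳ y)) (P.restore y)))))
    }
    where
    open ≡-Reasoning
    b₁w≢w : P.b₁ ⟨$⟩ʳ P.w ≢ P.w
    b₁w≢w b₁w≡w = 0≢1+n (trans (sym w-even) (cong parity (Cycles.ℓ-fixed P.b₁ b₁w≡w)))
    module Q = Peel P.b₁ b₁w≢w
    b₁-same : oddCycles P.b₁ ≡ oddCycles b
    b₁-same = trans (sym P.oddCycles-peeled) (trans (cong (λ k → oddCycles b + 2 * k) w-even) (+-identityʳ _))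
    w′-odd : parity (Cycles.ℓ Q.b₁ Q.w) ≡ 1
    w′-odd = trans (sym (+-identityˡ _)) (trans (cong (_+ parity (Cycles.ℓ Q.b₁ Q.w))
               (trans (sym w-even) (cong parity Q.ℓ-peeled))) (parity-suc (Cycles.ℓ Q.b₁ Q.w)))

private
  +2-cancel : ∀ {B B′ A M X X′} → B′ ≡ B + 2 → B′ + A ≤ M + X′ → X′ ≤ X + 2 → B + A ≤ M + X
  +2-cancel {B} {B′} {A} {M} {X} {X′} B′≡B+2 B′A≤MX′ X′≤X+2 = +-cancelʳ-≤ 2 _ _ (begin
    B + A + 2       ≡⟨ trans (+-assoc B A 2) (trans (cong (B +_) (+-comm A 2)) (sym (+-assoc B 2 A))) ⟩
    B + 2 + A       ≡⟨ cong (_+ A) B′≡B+2 ⟨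
    B′ + A          ≤⟨ B′A≤MX′ ⟩
    M + X′          ≤⟨ +-monoʳ-≤ M X′≤X+2 ⟩
    M + (X + 2)     ≡⟨ +-assoc M X 2 ⟨
    M + X + 2       ∎)
    where open ≤-Reasoning

  oddCycles-∘ₚ-fuel : ∀ n (b a : Permutation′ m) → moved b ≤ n →
                      oddCycles b + oddCycles a ≤ m + oddCycles (b ∘ₚ a)
  oddCycles-∘ₚ-fuel n b a moved≤n with any? (λ y → ¬? (b ⟨$⟩ʳ y ≟ y))
  oddCycles-∘ₚ-fuel {m} n b a moved≤n | no nothing-moved = ≤-reflexive (begin
    oddCycles b + oddCycles a          ≡⟨ cong (_+ oddCycles a) (oddCycles-id b fixes) ⟩
    m + oddCycles a                    ≡⟨ cong (m +_) (cOdd-cong λ y → cong (a ⟨$⟩ʳ_) (fixes y)) ⟨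
    m + oddCycles (b ∘ₚ a)             ∎)
    where
    open ≡-Reasoning
    fixes : ∀ y → b ⟨$⟩ʳ y ≡ y
    fixes y with b ⟨$⟩ʳ y ≟ y
    ... | yes by≡y = by≡y
    ... | no  by≢y = ⊥-elim (nothing-moved (y , by≢y))
  oddCycles-∘ₚ-fuel zero b a moved≤0 | yes (x , bx≢x) =
    ⊥-elim (n≮0 (≤-trans (Reduction.fewer-moved (reduction b bx≢x)) moved≤0))
  oddCycles-∘ₚ-fuel (suc n) b a moved≤1+n | yes (x , bx≢x) =
    +2-cancel R.oddCycles-+2 (oddCycles-∘ₚ-fuel n R.reduct a (≤-pred (≤-trans R.fewer-moved moved≤1+n)))
              (R.∘ₚ-≤ a)
    where module R = Reduction (reduction b bx≢x)

oddCycles-∘ₚ : ∀ (σ τ : Permutation′ m) → oddCycles σ + oddCycles τ ≤ m + oddCycles (σ ∘ₚ τ)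
oddCycles-∘ₚ σ τ = oddCycles-∘ₚ-fuel (moved σ) σ τ ≤-refl


-- The permutation π̄

unshiftCycle : ∀ {n} → Fin (suc n) → Fin (suc n)
unshiftCycle {n} zero    = fromℕ n
unshiftCycle     (suc i) = inject₁ i

module _ {n : ℕ} where

  shiftCycle-< : ∀ (k : Fin (suc n)) (k<n : toℕ k < n) → shiftCycle k ≡ suc (fromℕ< k<n)
  shiftCycle-< k k<n with toℕ k <? n
  ... | yes _   = refl
  ... | no  k≮n = ⊥-elim (k≮n k<n)

  shiftCycle-≮ : ∀ (k : Fin (suc n)) → ¬ toℕ k < n → shiftCycle k ≡ zero
  shiftCycle-≮ k k≮n with toℕ k <? n
  ... | yes k<n = ⊥-elim (k≮n k<n)
  ... | no  _   = refl

  unshift-shiftCycle : ∀ k → unshiftCycle (shiftCycle {n} k) ≡ k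
  unshift-shiftCycle k with toℕ k <? n
  ... | yes k<n = toℕ-injective (trans (toℕ-inject₁ (fromℕ< k<n)) (toℕ-fromℕ< k<n))
  ... | no  k≮n = toℕ-injective (trans (toℕ-fromℕ n) (sym (≤-antisym (≤-pred (toℕ<n k)) (≮⇒≥ k≮n))))

  shiftCycle-unshift : ∀ k → shiftCycle {n} (unshiftCycle k) ≡ k
  shiftCycle-unshift zero    = shiftCycle-≮ (fromℕ n) (<-irrefl (toℕ-fromℕ n))
  shiftCycle-unshift (suc i) = trans (shiftCycle-< (inject₁ i) i<n)
                                     (cong suc (toℕ-injective (trans (toℕ-fromℕ< i<n) (toℕ-inject₁ i))))
    where
    i<n : toℕ (inject₁ i) < n
    i<n = subst (_< n) (sym (toℕ-inject₁ i)) (toℕ<n i)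

  rotation : Permutation′ (suc n)
  rotation = permutation shiftCycle unshiftCycle shiftCycle-unshift unshift-shiftCycle

revCycle-conj : ∀ {n} (π : Permutation′ n) k →
                revCycle π k ≡ lift₀ π ⟨$⟩ʳ unshiftCycle (lift₀ π ⟨$⟩ˡ k)
revCycle-conj {zero}  π zero    = refl
revCycle-conj {suc m} π zero    = refl
revCycle-conj {suc m} π (suc y) with π ⟨$⟩ˡ y
... | zero  = refl
... | suc j = refl

corollary3 : (n : ℕ) (π : Permutation′ n) →
    2 * cOdd (π ⟨$⟩ʳ_) + 1 ≤ n + cOdd (piBar π)
corollary3 n π = subst (_≤ n + cOdd (piBar π)) (sym (2c+1 (oddCycles π))) (≤-pred (begin
  suc (oddCycles π) + suc (oddCycles π)           ≡⟨ cong₂ _+_ ĉ-flip ĉ-conj ⟨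
  oddCycles (flip π̂) + oddCycles sπ̂s⁻¹            ≤⟨ oddCycles-∘ₚ (flip π̂) sπ̂s⁻¹ ⟩
  suc n + oddCycles (flip π̂ ∘ₚ sπ̂s⁻¹)             ≡⟨ cong (suc n +_) (cOdd-cong λ k → cong shiftCycle (sym (revCycle-conj π k))) ⟩
  suc n + cOdd (piBar π)                          ∎))
  where
  open ≤-Reasoning
  π̂ = lift₀ π
  sπ̂s⁻¹ = flip rotation ∘ₚ π̂ ∘ₚ rotation
  ĉ-flip : oddCycles (flip π̂) ≡ suc (oddCycles π)
  ĉ-flip = trans (oddCycles-flip π̂) (oddCycles-lift₀ π)
  ĉ-conj : oddCycles sπ̂s⁻¹ ≡ suc (oddCycles π)
  ĉ-conj = trans (oddCycles-conj rotation π̂) (oddCycles-lift₀ π)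
  2c+1 : ∀ c → 2 * c + 1 ≡ c + suc c
  2c+1 = solve-∀
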